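{- Let $\mathcal{B}$ be the free strict monoidal category generated by one object $1$ and morphisms $\mu:2\to1$, $\eta:0\to1$, $\delta:1\to2$, $\varepsilon:1\to0$, $\gamma:2\to2$, and let $\equiv$ be the congruence generated by the twenty-two relations of bicommutative bialgebras (listed in the context). Then every morphism $\phi:m\to n$ of $\mathcal{B}$ is equivalent with respect to $\equiv$ to a precanonical form.
   Context: Write $X$ for $\mathrm{id}_1$, $k$ for $\mathrm{id}_k$ when used as a morphism, and $I=0$. The relations generating $\equiv$ are: $(\gamma\otimes X)\circ(X\otimes\gamma)\circ(\gamma\otimes X)=(X\otimes\gamma)\circ(\gamma\otimes X)\circ(X\otimes\gamma)$; $\gamma\circ\gamma=\mathrm{id}_2$; $\mu\circ(\mu\otimes X)=\mu\circ(X\otimes\mu)$; $\mu\circ(\eta\otimes X)=X=\mu\circ(X\otimes\eta)$; $\gamma\circ(\mu\otimes X)=(X\otimes\mu)\circ(\gamma\otimes X)\circ(X\otimes\gamma)$; $\gamma\circ(X\otimes\mu)=(\mu\otimes X)\circ(X\otimes\gamma)\circ(\gamma\otimes X)$; $\gamma\circ(\eta\otimes X)=X\otimes\eta$; $\gamma\circ(X\otimes\eta)=\eta\otimes X$; $\mu\circ\gamma=\mu$; $(\delta\otimes X)\circ\delta=(X\otimes\delta)\circ\delta$; $(\varepsilon\otimes X)\circ\delta=X=(X\otimes\varepsilon)\circ\delta$; $(\delta\otimes X)\circ\gamma=(X\otimes\gamma)\circ(\gamma\otimes X)\circ(X\otimes\delta)$; $(X\otimes\delta)\circ\gamma=(\gamma\otimes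 X)\circ(X\otimes\gamma)\circ(\delta\otimes X)$; $(\varepsilon\otimes X)\circ\gamma=X\otimes\varepsilon$; $(X\otimes\varepsilon)\circ\gamma=\varepsilon\otimes X$; $\gamma\circ\delta=\delta$; $\delta\circ\mu=(\mu\otimes\mu)\circ(X\otimes\gamma\otimes X)\circ(\delta\otimes\delta)$; $\varepsilon\circ\mu=\varepsilon\otimes\varepsilon$; $\delta\circ\eta=\eta\otimes\eta$; $\varepsilon\circ\eta=\mathrm{id}_I$. Stairs: $\gamma_0=\mathrm{id}_1$ and $\gamma_{i+1}=(\mathrm{id}_i\otimes\gamma)\circ(\gamma_i\otimes\mathrm{id}_1):i+2\to i+2$ (moving the first wire to position $i+1$). Precanonical forms are the morphisms generated by the grammar $\phi::=Z\mid H\phi\mid E\phi\mid W_i\phi$, where $Z=\mathrm{id}_0$; for a precanonical form $\phi':m\to n$: $H\phi'=\eta\otimes\phi':m\to n+1$, $E\phi'=\varepsilon\otimes\phi':m+1\to n$, and, when $m\ge1$ and $0\le i\le n-1$, $W_i\phi'=(\mathrm{id}_i\otimes\mu\otimes\mathrm{id}_{n-1-i})\circ(\gamma_i\otimes\mathrm{id}_{n-i})\circ(\mathrm{id}_1\otimes\phi')\circ(\delta\otimes\mathrm{id}_{m-1}):m\to n$. -}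

module Defs where

open import Data.Nat using (ℕ; zero; suc; _+_)
open import Data.Nat.Properties using (+-assoc; +-identityʳ; +-comm; +-suc)
open import Relation.Binary.PropositionalEquality using (_≡_; refl; sym; trans; cong)

infixr 9 _⊗_
infixr 5 _∘_

data Tm : ℕ → ℕ → Set where
  idₜ : (n : ℕ) → Tm n n
  μ   : Tm 2 1
  η   : Tm 0 1
  δ   : Tm 1 2
  ε   : Tm 1 0
  γ   : Tm 2 2
  _∘_ : {k m n : ℕ} → Tm m n → Tm k m → Tm k n
  _⊗_ : {m n m' n' : ℕ} → Tm m n → Tm m' n' → Tm (m + m') (n + n')

cast : {m n m' n' : ℕ} → m ≡ m' → n ≡ n' → Tm m n → Tm m' n'
cast refl refl f = f

X : Tm 1 1
X = idₜ 1

-- The congruence ≡ : generated by the strict monoidal category laws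
-- (which make Tm a presentation of the morphisms of B) together with
-- the twenty-two bicommutative bialgebra relations.
infix 4 _≈_

data _≈_ : {m n : ℕ} → Tm m n → Tm m n → Set where
  ≈-refl  : ∀ {m n} {f : Tm m n} → f ≈ f
  ≈-sym   : ∀ {m n} {f g : Tm m n} → f ≈ g → g ≈ f
  ≈-trans : ∀ {m n} {f g h : Tm m n} → f ≈ g → g ≈ h → f ≈ h
  ∘-cong  : ∀ {k m n} {f f' : Tm m n} {g g' : Tm k m} → f ≈ f' → g ≈ g' → (f ∘ g) ≈ (f' ∘ g')
  ⊗-cong  : ∀ {m n m' n'} {f f' : Tm m n} {g g' : Tm m' n'} → f ≈ f' → g ≈ g' → (f ⊗ g) ≈ (f' ⊗ g')
  ∘-assoc : ∀ {j k m n} (f : Tm m n) (g : Tm k m) (h : Tm j k) → ((f ∘ g) ∘ h) ≈ (f ∘ (g ∘ h))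
  ∘-idˡ   : ∀ {m n} (f : Tm m n) → (idₜ n ∘ f) ≈ f
  ∘-idʳ   : ∀ {m n} (f : Tm m n) → (f ∘ idₜ m) ≈ f
  ⊗-assoc : ∀ {m₁ n₁ m₂ n₂ m₃ n₃} (f : Tm m₁ n₁) (g : Tm m₂ n₂) (h : Tm m₃ n₃) →
            ((f ⊗ g) ⊗ h) ≈ cast (sym (+-assoc m₁ m₂ m₃)) (sym (+-assoc n₁ n₂ n₃)) (f ⊗ (g ⊗ h))
  ⊗-idˡ   : ∀ {m n} (f : Tm m n) → (idₜ 0 ⊗ f) ≈ f
  ⊗-idʳ   : ∀ {m n} (f : Tm m n) → (f ⊗ idₜ 0) ≈ cast (sym (+-identityʳ m)) (sym (+-identityʳ n)) f
  ⊗-id    : ∀ m n → (idₜ m ⊗ idₜ n) ≈ idₜ (m + n)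
  interchange : ∀ {k m n k' m' n'} (f : Tm m n) (g : Tm k m) (f' : Tm m' n') (g' : Tm k' m') →
            ((f ∘ g) ⊗ (f' ∘ g')) ≈ ((f ⊗ f') ∘ (g ⊗ g'))
  r1  : ((γ ⊗ X) ∘ (X ⊗ γ) ∘ (γ ⊗ X)) ≈ ((X ⊗ γ) ∘ (γ ⊗ X) ∘ (X ⊗ γ))
  r2  : (γ ∘ γ) ≈ idₜ 2
  r3  : (μ ∘ (μ ⊗ X)) ≈ (μ ∘ (X ⊗ μ))
  r4  : (μ ∘ (η ⊗ X)) ≈ X
  r5  : (μ ∘ (X ⊗ η)) ≈ X
  r6  : (γ ∘ (μ ⊗ X)) ≈ ((X ⊗ μ) ∘ (γ ⊗ X) ∘ (X ⊗ γ))
  r7  : (γ ∘ (X ⊗ μ)) ≈ ((μ ⊗ X) ∘ (X ⊗ γ) ∘ (γ ⊗ X))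
  r8  : (γ ∘ (η ⊗ X)) ≈ (X ⊗ η)
  r9  : (γ ∘ (X ⊗ η)) ≈ (η ⊗ X)
  r10 : (μ ∘ γ) ≈ μ
  r11 : ((δ ⊗ X) ∘ δ) ≈ ((X ⊗ δ) ∘ δ)
  r12 : ((ε ⊗ X) ∘ δ) ≈ X
  r13 : ((X ⊗ ε) ∘ δ) ≈ X
  r14 : ((δ ⊗ X) ∘ γ) ≈ ((X ⊗ γ) ∘ (γ ⊗ X) ∘ (X ⊗ δ))
  r15 : ((X ⊗ δ) ∘ γ) ≈ ((γ ⊗ X) ∘ (X ⊗ γ) ∘ (δ ⊗ X))
  r16 : ((ε ⊗ X) ∘ γ) ≈ (X ⊗ ε)
  r17 : ((X ⊗ ε) ∘ γ) ≈ (ε ⊗ X)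
  r18 : (γ ∘ δ) ≈ δ
  r19 : (δ ∘ μ) ≈ ((μ ⊗ μ) ∘ (X ⊗ γ ⊗ X) ∘ (δ ⊗ δ))
  r20 : (ε ∘ μ) ≈ (ε ⊗ ε)
  r21 : (δ ∘ η) ≈ (η ⊗ η)
  r22 : (ε ∘ η) ≈ idₜ 0

-- Stairs: γ₀ = id₁, γ_{i+1} = (id_i ⊗ γ) ∘ (γ_i ⊗ id₁) : i+2 → i+2
stair : (i : ℕ) → Tm (suc i) (suc i)
stair zero    = idₜ 1
stair (suc i) = cast (+-comm i 2) (+-comm i 2) (idₜ i ⊗ γ)
              ∘ cast (cong suc (+-comm i 1)) (cong suc (+-comm i 1)) (stair i ⊗ idₜ 1)

private
  eq2 : (i j : ℕ) → i + suc (suc j) ≡ suc (suc (i + j))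
  eq2 i j = trans (+-suc i (suc j)) (cong suc (+-suc i j))

-- W_i φ' for φ' : m → n with m = suc m', n = suc (i + j) (so 0 ≤ i ≤ n-1, n-1-i = j):
-- (id_i ⊗ μ ⊗ id_{n-1-i}) ∘ (γ_i ⊗ id_{n-i}) ∘ (id₁ ⊗ φ') ∘ (δ ⊗ id_{m-1})
Wmor : (i j : ℕ) {m' : ℕ} → Tm (suc m') (suc (i + j)) → Tm (suc m') (suc (i + j))
Wmor i j {m'} φ =
    cast (eq2 i j) (+-suc i j) (idₜ i ⊗ μ ⊗ idₜ j)
  ∘ cast (cong suc (+-suc i j)) (cong suc (+-suc i j)) (stair i ⊗ idₜ (suc j))
  ∘ (X ⊗ φ)
  ∘ (δ ⊗ idₜ m')

data Precanonical : {m n : ℕ} → Tm m n → Set where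
  Z : Precanonical (idₜ 0)
  H : ∀ {m n} {φ : Tm m n} → Precanonical φ → Precanonical (η ⊗ φ)
  E : ∀ {m n} {φ : Tm m n} → Precanonical φ → Precanonical (ε ⊗ φ)
  W : ∀ (i j : ℕ) {m'} {φ : Tm (suc m') (suc (i + j))} → Precanonical φ → Precanonical (Wmor i j φ)

module Submission where

-- Precanonical forms are first described by a syntax NF whose W-step uses
-- the merge map  merge i : n+1 → n  (carry wire 0 to position i by swaps,
-- then apply μ there); its meaning is defined by recursion on i, so no
-- casts appear.  Normal forms are then shown to contain the identities and
-- generators and to be closed under ⊗ and ∘, which gives a normal form for
-- every term by structural induction.  Closure under ∘ reduces to
-- absorption: a generator layer  X ⊗ … ⊗ X ⊗ g ⊗ id  on top of a normal
-- form yields a normal form.  Absorption is an induction over the normal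
-- form whose only real case is pushing the layer through a merge map: the
-- layer passes through, is killed (ε ∘ μ = ε ⊗ ε), or is duplicated
-- (δ ∘ μ, the bialgebra law).  Finally merge i is identified with the
-- stair-based prefix (id_i ⊗ μ ⊗ id) ∘ (γ_i ⊗ id) of W_i, which turns a
-- normal form into a term satisfying the Precanonical predicate.

open import Defs
open import Data.Nat using (ℕ; zero; suc; _+_; _∸_)
open import Data.Nat.Properties using (≡-irrelevant; +-assoc; +-suc; +-comm; m+[n∸m]≡n; suc-injective)
open import Data.Fin using (Fin; zero; suc; toℕ; _↑ˡ_)
open import Data.Fin.Properties using (toℕ≤pred[n])
open import Data.Product using (Σ; _×_; _,_)
open import Relation.Binary.PropositionalEquality using (_≡_; refl; sym; trans; cong; cong₂)
open import Relation.Binary.Bundles using (Setoid)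
import Relation.Binary.Reasoning.Setoid as SetoidReasoning

homSetoid : ℕ → ℕ → Setoid _ _
homSetoid m n = record
  { Carrier       = Tm m n
  ; _≈_           = _≈_
  ; isEquivalence = record { refl = ≈-refl ; sym = ≈-sym ; trans = ≈-trans }
  }

module ≈-Reasoning {m n : ℕ} = SetoidReasoning (homSetoid m n)
open ≈-Reasoning

infixr 6 _⟨∘⟩_
infixr 10 _⟨⊗⟩_

_⟨∘⟩_ : ∀ {k m n} {f f' : Tm m n} {g g' : Tm k m} → f ≈ f' → g ≈ g' → (f ∘ g) ≈ (f' ∘ g')
_⟨∘⟩_ = ∘-cong

_⟨⊗⟩_ : ∀ {m n m' n'} {f f' : Tm m n} {g g' : Tm m' n'} → f ≈ f' → g ≈ g' → (f ⊗ g) ≈ (f' ⊗ g')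
_⟨⊗⟩_ = ⊗-cong

fuse : ∀ {k m n k' m' n'} (f : Tm m n) (g : Tm k m) (f' : Tm m' n') (g' : Tm k' m') →
       ((f ⊗ f') ∘ (g ⊗ g')) ≈ ((f ∘ g) ⊗ (f' ∘ g'))
fuse f g f' g' = ≈-sym (interchange f g f' g')

factorʳ : ∀ {m n m' n'} (f : Tm m n) (g : Tm m' n') → (f ⊗ g) ≈ ((idₜ n ⊗ g) ∘ (f ⊗ idₜ m'))
factorʳ {m} {n} {m'} f g = begin
  f ⊗ g                      ≈⟨ ∘-idˡ f ⟨⊗⟩ ∘-idʳ g ⟨
  (idₜ n ∘ f) ⊗ (g ∘ idₜ m') ≈⟨ interchange _ _ _ _ ⟩
  (idₜ n ⊗ g) ∘ (f ⊗ idₜ m') ∎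

factorˡ : ∀ {m n m' n'} (f : Tm m n) (g : Tm m' n') → (f ⊗ g) ≈ ((f ⊗ idₜ n') ∘ (idₜ m ⊗ g))
factorˡ f g = begin
  f ⊗ g                      ≈⟨ ∘-idʳ f ⟨⊗⟩ ∘-idˡ g ⟨
  (f ∘ idₜ _) ⊗ (idₜ _ ∘ g)  ≈⟨ interchange _ _ _ _ ⟩
  (f ⊗ idₜ _) ∘ (idₜ _ ⊗ g)  ∎

disjoint-commute : ∀ {p q n n'} (A : Tm p q) (P : Tm n n') →
                   ((idₜ q ⊗ P) ∘ (A ⊗ idₜ n)) ≈ ((A ⊗ idₜ n') ∘ (idₜ p ⊗ P))
disjoint-commute A P = ≈-trans (≈-sym (factorʳ A P)) (factorˡ A P)

X⊗-∘ : ∀ {k m n} (f : Tm m n) (g : Tm k m) → (X ⊗ (f ∘ g)) ≈ ((X ⊗ f) ∘ (X ⊗ g))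
X⊗-∘ f g = ≈-trans (≈-sym (∘-idˡ X) ⟨⊗⟩ ≈-refl) (interchange X X f g)

⊗id-fuse : ∀ b {k m n} (f : Tm m n) (g : Tm k m) → ((f ⊗ idₜ b) ∘ (g ⊗ idₜ b)) ≈ ((f ∘ g) ⊗ idₜ b)
⊗id-fuse b f g = ≈-trans (fuse _ _ _ _) (≈-refl ⟨⊗⟩ ∘-idˡ _)

⊗id-fuse₃ : ∀ b {j k m n} (f : Tm m n) (g : Tm k m) (l : Tm j k) →
            ((f ⊗ idₜ b) ∘ (g ⊗ idₜ b) ∘ (l ⊗ idₜ b)) ≈ ((f ∘ g ∘ l) ⊗ idₜ b)
⊗id-fuse₃ b f g l = ≈-trans (≈-refl ⟨∘⟩ ⊗id-fuse b g l) (⊗id-fuse b f (g ∘ l))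

-- Instances of associativity where the leading factor has a literal size
-- (the general law ⊗-assoc involves a cast, which vanishes here).
X⊗-assoc : ∀ {m n m' n'} (f : Tm m n) (g : Tm m' n') → (X ⊗ (f ⊗ g)) ≈ ((X ⊗ f) ⊗ g)
X⊗-assoc f g = ≈-sym (⊗-assoc X f g)

idsuc⊗ : ∀ a {m n} (f : Tm m n) → (idₜ (suc a) ⊗ f) ≈ (X ⊗ (idₜ a ⊗ f))
idsuc⊗ a f = ≈-trans (≈-sym (⊗-id 1 a) ⟨⊗⟩ ≈-refl) (⊗-assoc X (idₜ a) f)

id₂⊗ : ∀ {m n} (f : Tm m n) → (idₜ 2 ⊗ f) ≈ (X ⊗ (X ⊗ f))
id₂⊗ = idsuc⊗ 1

cast-≈ : ∀ {m n m' n'} (p : m ≡ m') (q : n ≡ n') {f g : Tm m n} → f ≈ g → cast p q f ≈ cast p q g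
cast-≈ refl refl eq = eq

cast-cancel : ∀ {m n m' n'} (p : m ≡ m') (q : n ≡ n') (f : Tm m' n') → cast p q (cast (sym p) (sym q) f) ≡ f
cast-cancel refl refl f = refl

≡→≈ : ∀ {m n} {f g : Tm m n} → f ≡ g → f ≈ g
≡→≈ refl = ≈-refl

-- Splitting one wire off a block of identities.  The cast is the identity
-- as soon as p and q are literals, which is how the lemma is used.
⊗id-suc : ∀ {p q} (f : Tm p q) b →
          (f ⊗ idₜ (suc b)) ≈ cast (+-assoc p 1 b) (+-assoc q 1 b) ((f ⊗ X) ⊗ idₜ b)
⊗id-suc {p} {q} f b = begin
  f ⊗ idₜ (suc b)   ≈⟨ ≈-refl ⟨⊗⟩ ⊗-id 1 b ⟨
  f ⊗ (X ⊗ idₜ b)   ≡⟨ cast-cancel A B _ ⟨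
  cast A B (cast (sym A) (sym B) (f ⊗ (X ⊗ idₜ b)))
                    ≈⟨ cast-≈ A B (⊗-assoc f X (idₜ b)) ⟨
  cast A B ((f ⊗ X) ⊗ idₜ b) ∎
  where
  A : p + 1 + b ≡ p + suc b
  A = +-assoc p 1 b
  B : q + 1 + b ≡ q + suc b
  B = +-assoc q 1 b

disjoint-commute₂ : ∀ {n n'} (A : Tm 2 2) (P : Tm n n') →
                    ((X ⊗ (X ⊗ P)) ∘ (A ⊗ idₜ n)) ≈ ((A ⊗ idₜ n') ∘ (X ⊗ (X ⊗ P)))
disjoint-commute₂ A P = begin
  (X ⊗ (X ⊗ P)) ∘ (A ⊗ idₜ _) ≈⟨ id₂⊗ P ⟨∘⟩ ≈-refl ⟨
  (idₜ 2 ⊗ P) ∘ (A ⊗ idₜ _)   ≈⟨ disjoint-commute A P ⟩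
  (A ⊗ idₜ _) ∘ (idₜ 2 ⊗ P)   ≈⟨ ≈-refl ⟨∘⟩ id₂⊗ P ⟩
  (A ⊗ idₜ _) ∘ (X ⊗ (X ⊗ P)) ∎

η-on-top : ∀ {k N} (F : Tm k N) → ((η ⊗ idₜ N) ∘ F) ≈ (η ⊗ F)
η-on-top F = ≈-sym (≈-trans (factorˡ η F) (≈-refl ⟨∘⟩ ⊗-idˡ F))

-- Normal forms

-- merge i : n+1 → n carries wire 0 down to position i by swaps and then
-- multiplies it into the wire found there.  It plays the role of
-- (id_i ⊗ μ ⊗ id) ∘ (γ_i ⊗ id) in W_i, but is defined without casts.
merge : ∀ {n} → Fin n → Tm (suc n) n
merge {suc n} zero = μ ⊗ idₜ n
merge {suc n} (suc i) = (X ⊗ merge i) ∘ (γ ⊗ idₜ n)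

-- Syntax of precanonical forms: Z, Hφ, Eφ and W_i φ (with i : Fin n).
data NF : ℕ → ℕ → Set where
  nf-Z : NF 0 0
  nf-H : ∀ {m n} → NF m n → NF m (suc n)
  nf-E : ∀ {m n} → NF m n → NF (suc m) n
  nf-W : ∀ {m n} → Fin n → NF (suc m) n → NF (suc m) n

⟦_⟧ : ∀ {m n} → NF m n → Tm m n
⟦ nf-Z ⟧ = idₜ 0
⟦ nf-H ψ ⟧ = η ⊗ ⟦ ψ ⟧
⟦ nf-E ψ ⟧ = ε ⊗ ⟦ ψ ⟧
⟦ nf-W {m} i ψ ⟧ = merge i ∘ (X ⊗ ⟦ ψ ⟧) ∘ (δ ⊗ idₜ m)

HasNF : ∀ {m n} → Tm m n → Set
HasNF {m} {n} f = Σ (NF m n) λ ρ → f ≈ ⟦ ρ ⟧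

HasNF-≈ : ∀ {m n} {f g : Tm m n} → f ≈ g → HasNF g → HasNF f
HasNF-≈ f≈g (ρ , eq) = ρ , ≈-trans f≈g eq

data Ctx (m n : ℕ) : ℕ → ℕ → Set where
  oz : Ctx m n m n
  os : ∀ {M N} → Ctx m n M N → Ctx m n (suc M) (suc N)

plug : ∀ {m n M N} → Ctx m n M N → Tm m n → Tm M N
plug oz f = f
plug (os c) f = X ⊗ plug c f

-- Pushing a layer through a merge map

data PushResult {N N'} (P : Tm N N') (i : Fin N) : Set where
  pass : (i' : Fin N') → (P ∘ merge i) ≈ (merge i' ∘ (X ⊗ P)) → PushResult P i
  kill : (P ∘ merge i) ≈ (ε ⊗ P) → PushResult P i
  dup  : (i₁ i₂ : Fin N') → (P ∘ merge i) ≈ (merge i₁ ∘ (X ⊗ merge i₂) ∘ (δ ⊗ P)) → PushResult P i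

merge₀-commute : ∀ {n n'} (P : Tm n n') → ((X ⊗ P) ∘ (μ ⊗ idₜ n)) ≈ ((μ ⊗ idₜ n') ∘ (X ⊗ (X ⊗ P)))
merge₀-commute P = begin
  (X ⊗ P) ∘ (μ ⊗ idₜ _) ≈⟨ factorʳ μ P ⟨
  μ ⊗ P ≈⟨ factorˡ μ P ⟩
  (μ ⊗ idₜ _) ∘ (idₜ 2 ⊗ P) ≈⟨ ≈-refl ⟨∘⟩ id₂⊗ P ⟩
  (μ ⊗ idₜ _) ∘ (X ⊗ (X ⊗ P)) ∎

under-wire : ∀ {n n'} (P : Tm n n') (M : Tm (suc n) n) {K : Tm (suc n) n'} → (P ∘ M) ≈ K →
          ((X ⊗ P) ∘ ((X ⊗ M) ∘ (γ ⊗ idₜ n))) ≈ ((X ⊗ K) ∘ (γ ⊗ idₜ n))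
under-wire P M eq = begin
  (X ⊗ P) ∘ ((X ⊗ M) ∘ (γ ⊗ idₜ _)) ≈⟨ ∘-assoc _ _ _ ⟨
  ((X ⊗ P) ∘ (X ⊗ M)) ∘ (γ ⊗ idₜ _) ≈⟨ X⊗-∘ P M ⟨∘⟩ ≈-refl ⟨
  (X ⊗ (P ∘ M)) ∘ (γ ⊗ idₜ _) ≈⟨ (≈-refl ⟨⊗⟩ eq) ⟨∘⟩ ≈-refl ⟩
  _ ∎

lift-pass : ∀ {n n'} (P : Tm n n') (M : Tm (suc n) n) (M' : Tm (suc n') n') →
        (P ∘ M) ≈ (M' ∘ (X ⊗ P)) →
        ((X ⊗ P) ∘ ((X ⊗ M) ∘ (γ ⊗ idₜ n))) ≈ (((X ⊗ M') ∘ (γ ⊗ idₜ n')) ∘ (X ⊗ (X ⊗ P)))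
lift-pass P M M' eq = begin
  (X ⊗ P) ∘ ((X ⊗ M) ∘ (γ ⊗ idₜ _)) ≈⟨ under-wire P M eq ⟩
  (X ⊗ (M' ∘ (X ⊗ P))) ∘ (γ ⊗ idₜ _) ≈⟨ X⊗-∘ M' (X ⊗ P) ⟨∘⟩ ≈-refl ⟩
  ((X ⊗ M') ∘ (X ⊗ (X ⊗ P))) ∘ (γ ⊗ idₜ _) ≈⟨ ∘-assoc _ _ _ ⟩
  (X ⊗ M') ∘ ((X ⊗ (X ⊗ P)) ∘ (γ ⊗ idₜ _)) ≈⟨ ≈-refl ⟨∘⟩ disjoint-commute₂ γ P ⟩
  (X ⊗ M') ∘ ((γ ⊗ idₜ _) ∘ (X ⊗ (X ⊗ P))) ≈⟨ ∘-assoc _ _ _ ⟨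
  ((X ⊗ M') ∘ (γ ⊗ idₜ _)) ∘ (X ⊗ (X ⊗ P)) ∎

lift-kill : ∀ {n n'} (P : Tm n n') (M : Tm (suc n) n) →
        (P ∘ M) ≈ (ε ⊗ P) →
        ((X ⊗ P) ∘ ((X ⊗ M) ∘ (γ ⊗ idₜ n))) ≈ (ε ⊗ (X ⊗ P))
lift-kill P M eq = begin
  (X ⊗ P) ∘ ((X ⊗ M) ∘ (γ ⊗ idₜ _)) ≈⟨ under-wire P M eq ⟩
  (X ⊗ (ε ⊗ P)) ∘ (γ ⊗ idₜ _) ≈⟨ X⊗-assoc ε P ⟨∘⟩ ≈-refl ⟩
  ((X ⊗ ε) ⊗ P) ∘ (γ ⊗ idₜ _) ≈⟨ fuse _ _ _ _ ⟩
  ((X ⊗ ε) ∘ γ) ⊗ (P ∘ idₜ _) ≈⟨ r17 ⟨⊗⟩ ∘-idʳ P ⟩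
  (ε ⊗ X) ⊗ P ≈⟨ ⊗-assoc ε X P ⟩
  ε ⊗ (X ⊗ P) ∎

δ-past-swaps : ∀ {n n'} (P : Tm n n') →
  ((γ ⊗ idₜ (suc n')) ∘ (X ⊗ (γ ⊗ idₜ n')) ∘ (δ ⊗ (X ⊗ P))) ≈ ((X ⊗ (δ ⊗ P)) ∘ (γ ⊗ idₜ n))
δ-past-swaps {n} {n'} P = begin
  (γ ⊗ idₜ (suc n')) ∘ (X ⊗ (γ ⊗ idₜ n')) ∘ (δ ⊗ (X ⊗ P))
    ≈⟨ ⊗id-suc γ n' ⟨∘⟩ X⊗-assoc γ (idₜ n') ⟨∘⟩ ≈-sym (⊗-assoc δ X P) ⟩
  ((γ ⊗ X) ⊗ idₜ n') ∘ ((X ⊗ γ) ⊗ idₜ n') ∘ ((δ ⊗ X) ⊗ P)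
    ≈⟨ ≈-refl ⟨∘⟩ fuse _ _ _ _ ⟩
  ((γ ⊗ X) ⊗ idₜ n') ∘ (((X ⊗ γ) ∘ (δ ⊗ X)) ⊗ (idₜ n' ∘ P))
    ≈⟨ fuse _ _ _ _ ⟩
  ((γ ⊗ X) ∘ ((X ⊗ γ) ∘ (δ ⊗ X))) ⊗ (idₜ n' ∘ (idₜ n' ∘ P))
    ≈⟨ ≈-sym r15 ⟨⊗⟩ ≈-trans (∘-idˡ _) (≈-trans (∘-idˡ P) (≈-sym (∘-idʳ P))) ⟩
  ((X ⊗ δ) ∘ γ) ⊗ (P ∘ idₜ n) ≈⟨ interchange _ _ _ _ ⟩
  ((X ⊗ δ) ⊗ P) ∘ (γ ⊗ idₜ n) ≈⟨ ⊗-assoc X δ P ⟨∘⟩ ≈-refl ⟩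
  (X ⊗ (δ ⊗ P)) ∘ (γ ⊗ idₜ n) ∎

lift-dup : ∀ {n n'} (P : Tm n n') (M : Tm (suc n) n) (M1 M2 : Tm (suc n') n') →
        (P ∘ M) ≈ (M1 ∘ (X ⊗ M2) ∘ (δ ⊗ P)) →
        ((X ⊗ P) ∘ ((X ⊗ M) ∘ (γ ⊗ idₜ n))) ≈
        (((X ⊗ M1) ∘ (γ ⊗ idₜ n')) ∘ (X ⊗ ((X ⊗ M2) ∘ (γ ⊗ idₜ n'))) ∘ (δ ⊗ (X ⊗ P)))
lift-dup {n} {n'} P M M1 M2 eq = ≈-sym (begin
  ((X ⊗ M1) ∘ (γ ⊗ idₜ n')) ∘ (X ⊗ ((X ⊗ M2) ∘ (γ ⊗ idₜ n'))) ∘ (δ ⊗ (X ⊗ P))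
    ≈⟨ ∘-assoc _ _ _ ⟩
  (X ⊗ M1) ∘ (γ ⊗ idₜ n') ∘ (X ⊗ ((X ⊗ M2) ∘ (γ ⊗ idₜ n'))) ∘ (δ ⊗ (X ⊗ P))
    ≈⟨ ≈-refl ⟨∘⟩ ≈-refl ⟨∘⟩ X⊗-∘ _ _ ⟨∘⟩ ≈-refl ⟩
  (X ⊗ M1) ∘ (γ ⊗ idₜ n') ∘ ((X ⊗ (X ⊗ M2)) ∘ (X ⊗ (γ ⊗ idₜ n'))) ∘ (δ ⊗ (X ⊗ P))
    ≈⟨ ≈-refl ⟨∘⟩ ≈-refl ⟨∘⟩ ∘-assoc _ _ _ ⟩
  (X ⊗ M1) ∘ (γ ⊗ idₜ n') ∘ (X ⊗ (X ⊗ M2)) ∘ (X ⊗ (γ ⊗ idₜ n')) ∘ (δ ⊗ (X ⊗ P))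
    ≈⟨ ≈-refl ⟨∘⟩ ∘-assoc _ _ _ ⟨
  (X ⊗ M1) ∘ ((γ ⊗ idₜ n') ∘ (X ⊗ (X ⊗ M2))) ∘ (X ⊗ (γ ⊗ idₜ n')) ∘ (δ ⊗ (X ⊗ P))
    ≈⟨ ≈-refl ⟨∘⟩ disjoint-commute₂ γ M2 ⟨∘⟩ ≈-refl ⟨
  (X ⊗ M1) ∘ ((X ⊗ (X ⊗ M2)) ∘ (γ ⊗ idₜ (suc n'))) ∘ (X ⊗ (γ ⊗ idₜ n')) ∘ (δ ⊗ (X ⊗ P))
    ≈⟨ ≈-refl ⟨∘⟩ ∘-assoc _ _ _ ⟩
  (X ⊗ M1) ∘ (X ⊗ (X ⊗ M2)) ∘ (γ ⊗ idₜ (suc n')) ∘ (X ⊗ (γ ⊗ idₜ n')) ∘ (δ ⊗ (X ⊗ P))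
    ≈⟨ ≈-refl ⟨∘⟩ ≈-refl ⟨∘⟩ δ-past-swaps P ⟩
  (X ⊗ M1) ∘ (X ⊗ (X ⊗ M2)) ∘ (X ⊗ (δ ⊗ P)) ∘ (γ ⊗ idₜ n)
    ≈⟨ ≈-refl ⟨∘⟩ ∘-assoc _ _ _ ⟨
  (X ⊗ M1) ∘ ((X ⊗ (X ⊗ M2)) ∘ (X ⊗ (δ ⊗ P))) ∘ (γ ⊗ idₜ n)
    ≈⟨ ≈-refl ⟨∘⟩ X⊗-∘ _ _ ⟨∘⟩ ≈-refl ⟨
  (X ⊗ M1) ∘ (X ⊗ ((X ⊗ M2) ∘ (δ ⊗ P))) ∘ (γ ⊗ idₜ n)
    ≈⟨ ∘-assoc _ _ _ ⟨
  ((X ⊗ M1) ∘ (X ⊗ ((X ⊗ M2) ∘ (δ ⊗ P)))) ∘ (γ ⊗ idₜ n)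
    ≈⟨ X⊗-∘ _ _ ⟨∘⟩ ≈-refl ⟨
  (X ⊗ (M1 ∘ (X ⊗ M2) ∘ (δ ⊗ P))) ∘ (γ ⊗ idₜ n)
    ≈⟨ under-wire P M eq ⟨
  (X ⊗ P) ∘ ((X ⊗ M) ∘ (γ ⊗ idₜ n)) ∎)

lift-result : ∀ {n n'} (P : Tm n n') (i : Fin n) → PushResult P i → PushResult (X ⊗ P) (suc i)
lift-result P i (pass i' eq)    = pass (suc i') (lift-pass P (merge i) (merge i') eq)
lift-result P i (kill eq)       = kill (lift-kill P (merge i) eq)
lift-result P i (dup i₁ i₂ eq)  = dup (suc i₁) (suc i₂) (lift-dup P (merge i) (merge i₁) (merge i₂) eq)

μ-merge₁-absorbs : (μ ∘ ((X ⊗ μ) ∘ (γ ⊗ X))) ≈ (μ ∘ (X ⊗ μ))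
μ-merge₁-absorbs = begin
  μ ∘ ((X ⊗ μ) ∘ (γ ⊗ X)) ≈⟨ ∘-assoc _ _ _ ⟨
  (μ ∘ (X ⊗ μ)) ∘ (γ ⊗ X) ≈⟨ r3 ⟨∘⟩ ≈-refl ⟨
  (μ ∘ (μ ⊗ X)) ∘ (γ ⊗ X) ≈⟨ ∘-assoc _ _ _ ⟩
  μ ∘ ((μ ⊗ X) ∘ (γ ⊗ X)) ≈⟨ ≈-refl ⟨∘⟩ fuse _ _ _ _ ⟩
  μ ∘ ((μ ∘ γ) ⊗ (X ∘ X)) ≈⟨ ≈-refl ⟨∘⟩ (r10 ⟨⊗⟩ ∘-idˡ X) ⟩
  μ ∘ (μ ⊗ X) ≈⟨ r3 ⟩
  μ ∘ (X ⊗ μ) ∎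

δμ-as-merges : (δ ∘ μ) ≈ ((μ ⊗ X) ∘ (X ⊗ ((X ⊗ μ) ∘ (γ ⊗ X))) ∘ (δ ⊗ δ))
δμ-as-merges = begin
  δ ∘ μ ≈⟨ r19 ⟩
  (μ ⊗ μ) ∘ (X ⊗ γ ⊗ X) ∘ (δ ⊗ δ) ≈⟨ (≈-trans (factorˡ μ μ) (≈-refl ⟨∘⟩ id₂⊗ μ)) ⟨∘⟩ ≈-refl ⟩
  ((μ ⊗ X) ∘ (X ⊗ (X ⊗ μ))) ∘ (X ⊗ γ ⊗ X) ∘ (δ ⊗ δ) ≈⟨ ∘-assoc _ _ _ ⟩
  (μ ⊗ X) ∘ (X ⊗ (X ⊗ μ)) ∘ (X ⊗ γ ⊗ X) ∘ (δ ⊗ δ) ≈⟨ ≈-refl ⟨∘⟩ ∘-assoc _ _ _ ⟨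
  (μ ⊗ X) ∘ ((X ⊗ (X ⊗ μ)) ∘ (X ⊗ γ ⊗ X)) ∘ (δ ⊗ δ) ≈⟨ ≈-refl ⟨∘⟩ X⊗-∘ _ _ ⟨∘⟩ ≈-refl ⟨
  (μ ⊗ X) ∘ (X ⊗ ((X ⊗ μ) ∘ (γ ⊗ X))) ∘ (δ ⊗ δ) ∎

γ-merge₁ : (γ ∘ ((X ⊗ μ) ∘ (γ ⊗ X))) ≈ ((μ ⊗ X) ∘ (X ⊗ γ))
γ-merge₁ = begin
  γ ∘ ((X ⊗ μ) ∘ (γ ⊗ X)) ≈⟨ ∘-assoc _ _ _ ⟨
  (γ ∘ (X ⊗ μ)) ∘ (γ ⊗ X) ≈⟨ r7 ⟨∘⟩ ≈-refl ⟩
  ((μ ⊗ X) ∘ (X ⊗ γ) ∘ (γ ⊗ X)) ∘ (γ ⊗ X) ≈⟨ ≈-trans (∘-assoc _ _ _) (≈-refl ⟨∘⟩ ∘-assoc _ _ _) ⟩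
  (μ ⊗ X) ∘ (X ⊗ γ) ∘ ((γ ⊗ X) ∘ (γ ⊗ X)) ≈⟨ ≈-refl ⟨∘⟩ ≈-refl ⟨∘⟩ ≈-trans (fuse _ _ _ _) (≈-trans (r2 ⟨⊗⟩ ∘-idˡ X) (⊗-id 2 1)) ⟩
  (μ ⊗ X) ∘ (X ⊗ γ) ∘ idₜ 3 ≈⟨ ≈-refl ⟨∘⟩ ∘-idʳ _ ⟩
  (μ ⊗ X) ∘ (X ⊗ γ) ∎

η-past-merge : ∀ b (i : Fin b) → ((η ⊗ idₜ b) ∘ merge i) ≈ (merge (suc i) ∘ (X ⊗ (η ⊗ idₜ b)))
η-past-merge b i = ≈-sym (begin
  ((X ⊗ merge i) ∘ (γ ⊗ idₜ b)) ∘ (X ⊗ (η ⊗ idₜ b)) ≈⟨ ∘-assoc _ _ _ ⟩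
  (X ⊗ merge i) ∘ ((γ ⊗ idₜ b) ∘ (X ⊗ (η ⊗ idₜ b))) ≈⟨ ≈-refl ⟨∘⟩ (≈-refl ⟨∘⟩ X⊗-assoc η (idₜ b)) ⟩
  (X ⊗ merge i) ∘ ((γ ⊗ idₜ b) ∘ ((X ⊗ η) ⊗ idₜ b)) ≈⟨ ≈-refl ⟨∘⟩ ⊗id-fuse b γ (X ⊗ η) ⟩
  (X ⊗ merge i) ∘ ((γ ∘ (X ⊗ η)) ⊗ idₜ b) ≈⟨ ≈-refl ⟨∘⟩ (r9 ⟨⊗⟩ ≈-refl) ⟩
  (X ⊗ merge i) ∘ ((η ⊗ X) ⊗ idₜ b) ≈⟨ ≈-refl ⟨∘⟩ ⊗id-suc η b ⟨
  (X ⊗ merge i) ∘ (η ⊗ idₜ (suc b)) ≈⟨ fuse _ _ _ _ ⟩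
  (X ∘ η) ⊗ (merge i ∘ idₜ (suc b)) ≈⟨ ∘-idˡ η ⟨⊗⟩ ∘-idʳ _ ⟩
  η ⊗ merge i ≈⟨ η-on-top (merge i) ⟨
  (η ⊗ idₜ b) ∘ merge i ∎)

braid-⊗id : ∀ b → ((γ ⊗ idₜ (suc b)) ∘ (X ⊗ (γ ⊗ idₜ b)) ∘ (γ ⊗ idₜ (suc b))) ≈
      ((X ⊗ (γ ⊗ idₜ b)) ∘ (γ ⊗ idₜ (suc b)) ∘ (X ⊗ (γ ⊗ idₜ b)))
braid-⊗id b = begin
  (γ ⊗ idₜ (suc b)) ∘ (X ⊗ (γ ⊗ idₜ b)) ∘ (γ ⊗ idₜ (suc b)) ≈⟨ ⊗id-suc γ b ⟨∘⟩ X⊗-assoc γ (idₜ b) ⟨∘⟩ ⊗id-suc γ b ⟩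
  ((γ ⊗ X) ⊗ idₜ b) ∘ ((X ⊗ γ) ⊗ idₜ b) ∘ ((γ ⊗ X) ⊗ idₜ b) ≈⟨ ⊗id-fuse₃ b _ _ _ ⟩
  ((γ ⊗ X) ∘ (X ⊗ γ) ∘ (γ ⊗ X)) ⊗ idₜ b ≈⟨ r1 ⟨⊗⟩ ≈-refl ⟩
  ((X ⊗ γ) ∘ (γ ⊗ X) ∘ (X ⊗ γ)) ⊗ idₜ b ≈⟨ ⊗id-fuse₃ b _ _ _ ⟨
  ((X ⊗ γ) ⊗ idₜ b) ∘ ((γ ⊗ X) ⊗ idₜ b) ∘ ((X ⊗ γ) ⊗ idₜ b) ≈⟨ X⊗-assoc γ (idₜ b) ⟨∘⟩ ⊗id-suc γ b ⟨∘⟩ X⊗-assoc γ (idₜ b) ⟨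
  (X ⊗ (γ ⊗ idₜ b)) ∘ (γ ⊗ idₜ (suc b)) ∘ (X ⊗ (γ ⊗ idₜ b)) ∎

-- ε kills a merge at its own wire (ε ∘ μ = ε ⊗ ε) and passes the others.
push-ε : ∀ b (i : Fin (suc b)) → PushResult (ε ⊗ idₜ b) i
push-ε b zero = kill (begin
  (ε ⊗ idₜ b) ∘ (μ ⊗ idₜ b) ≈⟨ ⊗id-fuse b ε μ ⟩
  (ε ∘ μ) ⊗ idₜ b ≈⟨ r20 ⟨⊗⟩ ≈-refl ⟩
  (ε ⊗ ε) ⊗ idₜ b ≈⟨ ⊗-assoc ε ε (idₜ b) ⟩
  ε ⊗ (ε ⊗ idₜ b) ∎)
push-ε b (suc i) = pass i (begin
  (ε ⊗ idₜ b) ∘ ((X ⊗ merge i) ∘ (γ ⊗ idₜ b)) ≈⟨ ∘-assoc _ _ _ ⟨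
  ((ε ⊗ idₜ b) ∘ (X ⊗ merge i)) ∘ (γ ⊗ idₜ b) ≈⟨ fuse _ _ _ _ ⟨∘⟩ ≈-refl ⟩
  ((ε ∘ X) ⊗ (idₜ b ∘ merge i)) ∘ (γ ⊗ idₜ b) ≈⟨ (∘-idʳ ε ⟨⊗⟩ ∘-idˡ _) ⟨∘⟩ ≈-refl ⟩
  (ε ⊗ merge i) ∘ (γ ⊗ idₜ b) ≈⟨ factorʳ ε (merge i) ⟨∘⟩ ≈-refl ⟩
  ((idₜ 0 ⊗ merge i) ∘ (ε ⊗ idₜ (suc b))) ∘ (γ ⊗ idₜ b) ≈⟨ ∘-assoc _ _ _ ⟩
  (idₜ 0 ⊗ merge i) ∘ ((ε ⊗ idₜ (suc b)) ∘ (γ ⊗ idₜ b)) ≈⟨ ⊗-idˡ _ ⟨∘⟩ (⊗id-suc ε b ⟨∘⟩ ≈-refl) ⟩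
  merge i ∘ (((ε ⊗ X) ⊗ idₜ b) ∘ (γ ⊗ idₜ b)) ≈⟨ ≈-refl ⟨∘⟩ ⊗id-fuse b _ _ ⟩
  merge i ∘ (((ε ⊗ X) ∘ γ) ⊗ idₜ b) ≈⟨ ≈-refl ⟨∘⟩ (r16 ⟨⊗⟩ ≈-refl) ⟩
  merge i ∘ ((X ⊗ ε) ⊗ idₜ b) ≈⟨ ≈-refl ⟨∘⟩ X⊗-assoc ε (idₜ b) ⟨
  merge i ∘ (X ⊗ (ε ⊗ idₜ b)) ∎)

-- μ passes through merges by associativity and commutativity.
push-μ : ∀ b (i : Fin (2 + b)) → PushResult (μ ⊗ idₜ b) i
push-μ b zero = pass zero (begin
  (μ ⊗ idₜ b) ∘ (μ ⊗ idₜ (suc b)) ≈⟨ ≈-refl ⟨∘⟩ ⊗id-suc μ b ⟩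
  (μ ⊗ idₜ b) ∘ ((μ ⊗ X) ⊗ idₜ b) ≈⟨ ⊗id-fuse b _ _ ⟩
  (μ ∘ (μ ⊗ X)) ⊗ idₜ b ≈⟨ r3 ⟨⊗⟩ ≈-refl ⟩
  (μ ∘ (X ⊗ μ)) ⊗ idₜ b ≈⟨ ⊗id-fuse b _ _ ⟨
  (μ ⊗ idₜ b) ∘ ((X ⊗ μ) ⊗ idₜ b) ≈⟨ ≈-refl ⟨∘⟩ X⊗-assoc μ (idₜ b) ⟨
  (μ ⊗ idₜ b) ∘ (X ⊗ (μ ⊗ idₜ b)) ∎)
push-μ b (suc zero) = pass zero (begin
  (μ ⊗ idₜ b) ∘ ((X ⊗ (μ ⊗ idₜ b)) ∘ (γ ⊗ idₜ (suc b))) ≈⟨ ≈-refl ⟨∘⟩ (X⊗-assoc μ (idₜ b) ⟨∘⟩ ⊗id-suc γ b) ⟩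
  (μ ⊗ idₜ b) ∘ (((X ⊗ μ) ⊗ idₜ b) ∘ ((γ ⊗ X) ⊗ idₜ b)) ≈⟨ ⊗id-fuse₃ b _ _ _ ⟩
  (μ ∘ ((X ⊗ μ) ∘ (γ ⊗ X))) ⊗ idₜ b ≈⟨ μ-merge₁-absorbs ⟨⊗⟩ ≈-refl ⟩
  (μ ∘ (X ⊗ μ)) ⊗ idₜ b ≈⟨ ⊗id-fuse b _ _ ⟨
  (μ ⊗ idₜ b) ∘ ((X ⊗ μ) ⊗ idₜ b) ≈⟨ ≈-refl ⟨∘⟩ X⊗-assoc μ (idₜ b) ⟨
  (μ ⊗ idₜ b) ∘ (X ⊗ (μ ⊗ idₜ b)) ∎)
push-μ b (suc (suc i)) = pass (suc i) (begin
  (μ ⊗ idₜ b) ∘ ((X ⊗ ((X ⊗ merge i) ∘ (γ ⊗ idₜ b))) ∘ (γ ⊗ idₜ (suc b)))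
    ≈⟨ ≈-refl ⟨∘⟩ (X⊗-∘ _ _ ⟨∘⟩ ≈-refl) ⟩
  (μ ⊗ idₜ b) ∘ (((X ⊗ (X ⊗ merge i)) ∘ (X ⊗ (γ ⊗ idₜ b))) ∘ (γ ⊗ idₜ (suc b)))
    ≈⟨ ≈-refl ⟨∘⟩ ∘-assoc _ _ _ ⟩
  (μ ⊗ idₜ b) ∘ (X ⊗ (X ⊗ merge i)) ∘ (X ⊗ (γ ⊗ idₜ b)) ∘ (γ ⊗ idₜ (suc b))
    ≈⟨ ∘-assoc _ _ _ ⟨
  ((μ ⊗ idₜ b) ∘ (X ⊗ (X ⊗ merge i))) ∘ (X ⊗ (γ ⊗ idₜ b)) ∘ (γ ⊗ idₜ (suc b))
    ≈⟨ merge₀-commute (merge i) ⟨∘⟩ ≈-refl ⟨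
  ((X ⊗ merge i) ∘ (μ ⊗ idₜ (suc b))) ∘ (X ⊗ (γ ⊗ idₜ b)) ∘ (γ ⊗ idₜ (suc b))
    ≈⟨ ∘-assoc _ _ _ ⟩
  (X ⊗ merge i) ∘ (μ ⊗ idₜ (suc b)) ∘ (X ⊗ (γ ⊗ idₜ b)) ∘ (γ ⊗ idₜ (suc b))
    ≈⟨ ≈-refl ⟨∘⟩ (⊗id-suc μ b ⟨∘⟩ X⊗-assoc γ (idₜ b) ⟨∘⟩ ⊗id-suc γ b) ⟩
  (X ⊗ merge i) ∘ ((μ ⊗ X) ⊗ idₜ b) ∘ ((X ⊗ γ) ⊗ idₜ b) ∘ ((γ ⊗ X) ⊗ idₜ b)
    ≈⟨ ≈-refl ⟨∘⟩ ⊗id-fuse₃ b _ _ _ ⟩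
  (X ⊗ merge i) ∘ (((μ ⊗ X) ∘ (X ⊗ γ) ∘ (γ ⊗ X)) ⊗ idₜ b)
    ≈⟨ ≈-refl ⟨∘⟩ (r7 ⟨⊗⟩ ≈-refl) ⟨
  (X ⊗ merge i) ∘ ((γ ∘ (X ⊗ μ)) ⊗ idₜ b)
    ≈⟨ ≈-refl ⟨∘⟩ ⊗id-fuse b _ _ ⟨
  (X ⊗ merge i) ∘ ((γ ⊗ idₜ b) ∘ ((X ⊗ μ) ⊗ idₜ b))
    ≈⟨ ≈-refl ⟨∘⟩ (≈-refl ⟨∘⟩ X⊗-assoc μ (idₜ b)) ⟨
  (X ⊗ merge i) ∘ ((γ ⊗ idₜ b) ∘ (X ⊗ (μ ⊗ idₜ b)))
    ≈⟨ ∘-assoc _ _ _ ⟨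
  ((X ⊗ merge i) ∘ (γ ⊗ idₜ b)) ∘ (X ⊗ (μ ⊗ idₜ b)) ∎)

-- δ duplicates a merge at its own wire (the bialgebra law) and passes the others.
push-δ : ∀ b (i : Fin (suc b)) → PushResult (δ ⊗ idₜ b) i
push-δ b zero = dup zero (suc zero) (≈-sym (begin
  (μ ⊗ idₜ (suc b)) ∘ (X ⊗ ((X ⊗ (μ ⊗ idₜ b)) ∘ (γ ⊗ idₜ (suc b)))) ∘ (δ ⊗ (δ ⊗ idₜ b))
    ≈⟨ ⊗id-suc μ b ⟨∘⟩ (≈-refl ⟨⊗⟩ (X⊗-assoc μ (idₜ b) ⟨∘⟩ ⊗id-suc γ b)) ⟨∘⟩ ≈-sym (⊗-assoc δ δ (idₜ b)) ⟩
  ((μ ⊗ X) ⊗ idₜ b) ∘ (X ⊗ (((X ⊗ μ) ⊗ idₜ b) ∘ ((γ ⊗ X) ⊗ idₜ b))) ∘ ((δ ⊗ δ) ⊗ idₜ b)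
    ≈⟨ ≈-refl ⟨∘⟩ (≈-trans (≈-refl ⟨⊗⟩ ⊗id-fuse b _ _) (X⊗-assoc _ (idₜ b))) ⟨∘⟩ ≈-refl ⟩
  ((μ ⊗ X) ⊗ idₜ b) ∘ ((X ⊗ ((X ⊗ μ) ∘ (γ ⊗ X))) ⊗ idₜ b) ∘ ((δ ⊗ δ) ⊗ idₜ b)
    ≈⟨ ⊗id-fuse₃ b _ _ _ ⟩
  ((μ ⊗ X) ∘ (X ⊗ ((X ⊗ μ) ∘ (γ ⊗ X))) ∘ (δ ⊗ δ)) ⊗ idₜ b
    ≈⟨ δμ-as-merges ⟨⊗⟩ ≈-refl ⟨
  (δ ∘ μ) ⊗ idₜ b ≈⟨ ⊗id-fuse b _ _ ⟨
  (δ ⊗ idₜ b) ∘ (μ ⊗ idₜ b) ∎))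
push-δ b (suc i) = pass (suc (suc i)) (begin
  (δ ⊗ idₜ b) ∘ ((X ⊗ merge i) ∘ (γ ⊗ idₜ b)) ≈⟨ ∘-assoc _ _ _ ⟨
  ((δ ⊗ idₜ b) ∘ (X ⊗ merge i)) ∘ (γ ⊗ idₜ b) ≈⟨ fuse _ _ _ _ ⟨∘⟩ ≈-refl ⟩
  ((δ ∘ X) ⊗ (idₜ b ∘ merge i)) ∘ (γ ⊗ idₜ b) ≈⟨ (∘-idʳ δ ⟨⊗⟩ ∘-idˡ _) ⟨∘⟩ ≈-refl ⟩
  (δ ⊗ merge i) ∘ (γ ⊗ idₜ b) ≈⟨ factorʳ δ (merge i) ⟨∘⟩ ≈-refl ⟩
  ((idₜ 2 ⊗ merge i) ∘ (δ ⊗ idₜ (suc b))) ∘ (γ ⊗ idₜ b) ≈⟨ ∘-assoc _ _ _ ⟩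
  (idₜ 2 ⊗ merge i) ∘ ((δ ⊗ idₜ (suc b)) ∘ (γ ⊗ idₜ b)) ≈⟨ id₂⊗ (merge i) ⟨∘⟩ (⊗id-suc δ b ⟨∘⟩ ≈-refl) ⟩
  (X ⊗ (X ⊗ merge i)) ∘ (((δ ⊗ X) ⊗ idₜ b) ∘ (γ ⊗ idₜ b)) ≈⟨ ≈-refl ⟨∘⟩ ⊗id-fuse b _ _ ⟩
  (X ⊗ (X ⊗ merge i)) ∘ (((δ ⊗ X) ∘ γ) ⊗ idₜ b) ≈⟨ ≈-refl ⟨∘⟩ (r14 ⟨⊗⟩ ≈-refl) ⟩
  (X ⊗ (X ⊗ merge i)) ∘ (((X ⊗ γ) ∘ (γ ⊗ X) ∘ (X ⊗ δ)) ⊗ idₜ b) ≈⟨ ≈-refl ⟨∘⟩ ⊗id-fuse₃ b _ _ _ ⟨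
  (X ⊗ (X ⊗ merge i)) ∘ ((X ⊗ γ) ⊗ idₜ b) ∘ ((γ ⊗ X) ⊗ idₜ b) ∘ ((X ⊗ δ) ⊗ idₜ b)
    ≈⟨ ≈-refl ⟨∘⟩ (X⊗-assoc γ (idₜ b) ⟨∘⟩ ⊗id-suc γ b ⟨∘⟩ X⊗-assoc δ (idₜ b)) ⟨
  (X ⊗ (X ⊗ merge i)) ∘ (X ⊗ (γ ⊗ idₜ b)) ∘ (γ ⊗ idₜ (suc b)) ∘ (X ⊗ (δ ⊗ idₜ b))
    ≈⟨ ∘-assoc _ _ _ ⟨
  ((X ⊗ (X ⊗ merge i)) ∘ (X ⊗ (γ ⊗ idₜ b))) ∘ (γ ⊗ idₜ (suc b)) ∘ (X ⊗ (δ ⊗ idₜ b))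
    ≈⟨ X⊗-∘ _ _ ⟨∘⟩ ≈-refl ⟨
  (X ⊗ ((X ⊗ merge i) ∘ (γ ⊗ idₜ b))) ∘ (γ ⊗ idₜ (suc b)) ∘ (X ⊗ (δ ⊗ idₜ b))
    ≈⟨ ∘-assoc _ _ _ ⟨
  ((X ⊗ ((X ⊗ merge i) ∘ (γ ⊗ idₜ b))) ∘ (γ ⊗ idₜ (suc b))) ∘ (X ⊗ (δ ⊗ idₜ b)) ∎)

-- γ passes through merges, exchanging the positions 0 and 1.
push-γ : ∀ b (i : Fin (2 + b)) → PushResult (γ ⊗ idₜ b) i
push-γ b zero = pass (suc zero) (begin
  (γ ⊗ idₜ b) ∘ (μ ⊗ idₜ (suc b)) ≈⟨ ≈-refl ⟨∘⟩ ⊗id-suc μ b ⟩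
  (γ ⊗ idₜ b) ∘ ((μ ⊗ X) ⊗ idₜ b) ≈⟨ ⊗id-fuse b _ _ ⟩
  (γ ∘ (μ ⊗ X)) ⊗ idₜ b ≈⟨ r6 ⟨⊗⟩ ≈-refl ⟩
  ((X ⊗ μ) ∘ (γ ⊗ X) ∘ (X ⊗ γ)) ⊗ idₜ b ≈⟨ ⊗id-fuse₃ b _ _ _ ⟨
  ((X ⊗ μ) ⊗ idₜ b) ∘ ((γ ⊗ X) ⊗ idₜ b) ∘ ((X ⊗ γ) ⊗ idₜ b) ≈⟨ X⊗-assoc μ (idₜ b) ⟨∘⟩ ⊗id-suc γ b ⟨∘⟩ X⊗-assoc γ (idₜ b) ⟨
  (X ⊗ (μ ⊗ idₜ b)) ∘ (γ ⊗ idₜ (suc b)) ∘ (X ⊗ (γ ⊗ idₜ b)) ≈⟨ ∘-assoc _ _ _ ⟨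
  ((X ⊗ (μ ⊗ idₜ b)) ∘ (γ ⊗ idₜ (suc b))) ∘ (X ⊗ (γ ⊗ idₜ b)) ∎)
push-γ b (suc zero) = pass zero (begin
  (γ ⊗ idₜ b) ∘ ((X ⊗ (μ ⊗ idₜ b)) ∘ (γ ⊗ idₜ (suc b))) ≈⟨ ≈-refl ⟨∘⟩ (X⊗-assoc μ (idₜ b) ⟨∘⟩ ⊗id-suc γ b) ⟩
  (γ ⊗ idₜ b) ∘ (((X ⊗ μ) ⊗ idₜ b) ∘ ((γ ⊗ X) ⊗ idₜ b)) ≈⟨ ⊗id-fuse₃ b _ _ _ ⟩
  (γ ∘ ((X ⊗ μ) ∘ (γ ⊗ X))) ⊗ idₜ b ≈⟨ γ-merge₁ ⟨⊗⟩ ≈-refl ⟩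
  ((μ ⊗ X) ∘ (X ⊗ γ)) ⊗ idₜ b ≈⟨ ⊗id-fuse b _ _ ⟨
  ((μ ⊗ X) ⊗ idₜ b) ∘ ((X ⊗ γ) ⊗ idₜ b) ≈⟨ ⊗id-suc μ b ⟨∘⟩ X⊗-assoc γ (idₜ b) ⟨
  (μ ⊗ idₜ (suc b)) ∘ (X ⊗ (γ ⊗ idₜ b)) ∎)
push-γ b (suc (suc i)) = pass (suc (suc i)) (begin
  (γ ⊗ idₜ b) ∘ ((X ⊗ ((X ⊗ merge i) ∘ (γ ⊗ idₜ b))) ∘ (γ ⊗ idₜ (suc b)))
    ≈⟨ ≈-refl ⟨∘⟩ (X⊗-∘ _ _ ⟨∘⟩ ≈-refl) ⟩
  (γ ⊗ idₜ b) ∘ (((X ⊗ (X ⊗ merge i)) ∘ (X ⊗ (γ ⊗ idₜ b))) ∘ (γ ⊗ idₜ (suc b)))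
    ≈⟨ ≈-refl ⟨∘⟩ ∘-assoc _ _ _ ⟩
  (γ ⊗ idₜ b) ∘ (X ⊗ (X ⊗ merge i)) ∘ (X ⊗ (γ ⊗ idₜ b)) ∘ (γ ⊗ idₜ (suc b))
    ≈⟨ ∘-assoc _ _ _ ⟨
  ((γ ⊗ idₜ b) ∘ (X ⊗ (X ⊗ merge i))) ∘ (X ⊗ (γ ⊗ idₜ b)) ∘ (γ ⊗ idₜ (suc b))
    ≈⟨ disjoint-commute₂ γ (merge i) ⟨∘⟩ ≈-refl ⟨
  ((X ⊗ (X ⊗ merge i)) ∘ (γ ⊗ idₜ (suc b))) ∘ (X ⊗ (γ ⊗ idₜ b)) ∘ (γ ⊗ idₜ (suc b))
    ≈⟨ ∘-assoc _ _ _ ⟩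
  (X ⊗ (X ⊗ merge i)) ∘ (γ ⊗ idₜ (suc b)) ∘ (X ⊗ (γ ⊗ idₜ b)) ∘ (γ ⊗ idₜ (suc b))
    ≈⟨ ≈-refl ⟨∘⟩ braid-⊗id b ⟩
  (X ⊗ (X ⊗ merge i)) ∘ (X ⊗ (γ ⊗ idₜ b)) ∘ (γ ⊗ idₜ (suc b)) ∘ (X ⊗ (γ ⊗ idₜ b))
    ≈⟨ ∘-assoc _ _ _ ⟨
  ((X ⊗ (X ⊗ merge i)) ∘ (X ⊗ (γ ⊗ idₜ b))) ∘ (γ ⊗ idₜ (suc b)) ∘ (X ⊗ (γ ⊗ idₜ b))
    ≈⟨ X⊗-∘ _ _ ⟨∘⟩ ≈-refl ⟨
  (X ⊗ ((X ⊗ merge i) ∘ (γ ⊗ idₜ b))) ∘ (γ ⊗ idₜ (suc b)) ∘ (X ⊗ (γ ⊗ idₜ b))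
    ≈⟨ ∘-assoc _ _ _ ⟨
  ((X ⊗ ((X ⊗ merge i) ∘ (γ ⊗ idₜ b))) ∘ (γ ⊗ idₜ (suc b))) ∘ (X ⊗ (γ ⊗ idₜ b)) ∎)

-- The generators, so that layers can be treated uniformly.
data Gen : ℕ → ℕ → Set where
  gμ : Gen 2 1
  gη : Gen 0 1
  gδ : Gen 1 2
  gε : Gen 1 0
  gγ : Gen 2 2

⌜_⌝ : ∀ {p q} → Gen p q → Tm p q
⌜ gμ ⌝ = μ
⌜ gη ⌝ = η
⌜ gδ ⌝ = δ
⌜ gε ⌝ = ε
⌜ gγ ⌝ = γ

push-generator : ∀ {p q} (g : Gen p q) b (i : Fin (p + b)) → PushResult (⌜ g ⌝ ⊗ idₜ b) i
push-generator gμ b i = push-μ b i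
push-generator gη b i = pass (suc i) (η-past-merge b i)
push-generator gδ b i = push-δ b i
push-generator gε b i = push-ε b i
push-generator gγ b i = push-γ b i

push-layer : ∀ {p q} (g : Gen p q) b {N N'} (c : Ctx (p + b) (q + b) N N') (i : Fin N) →
    PushResult (plug c (⌜ g ⌝ ⊗ idₜ b)) i
push-layer g b oz i = push-generator g b i
push-layer g b (os c) zero = pass zero (merge₀-commute (plug c _))
push-layer g b (os c) (suc i) = lift-result _ i (push-layer g b c i)

-- Absorption of a layer into a normal form

ε-slide-out : ∀ {k m N} (L : Tm m N) (F : Tm k m) → (L ∘ (ε ⊗ F)) ≈ (ε ⊗ (L ∘ F))
ε-slide-out L F = begin
  L ∘ (ε ⊗ F) ≈⟨ ⊗-idˡ L ⟨∘⟩ ≈-refl ⟨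
  (idₜ 0 ⊗ L) ∘ (ε ⊗ F) ≈⟨ fuse _ _ _ _ ⟩
  (idₜ 0 ∘ ε) ⊗ (L ∘ F) ≈⟨ ∘-idˡ ε ⟨⊗⟩ ≈-refl ⟩
  ε ⊗ (L ∘ F) ∎

η-under-wire : ∀ {k m N} (L : Tm m N) (F : Tm k m) → ((X ⊗ L) ∘ (η ⊗ F)) ≈ (η ⊗ (L ∘ F))
η-under-wire L F = ≈-trans (fuse _ _ _ _) (∘-idˡ η ⟨⊗⟩ ≈-refl)

η-below : ∀ {k m N} {L : Tm m N} {ψ : NF k m} → HasNF (L ∘ ⟦ ψ ⟧) → HasNF ((X ⊗ L) ∘ (η ⊗ ⟦ ψ ⟧))
η-below (ρ , eq) = nf-H ρ , ≈-trans (η-under-wire _ _) (≈-refl ⟨⊗⟩ eq)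

ε∘η-cancel : ∀ {k n} (F : Tm k n) → ((ε ⊗ idₜ n) ∘ (η ⊗ F)) ≈ F
ε∘η-cancel F = ≈-trans (fuse _ _ _ _) (≈-trans (r22 ⟨⊗⟩ ∘-idˡ F) (⊗-idˡ F))

onto-η : ∀ {k q} (f : Tm 2 q) b (F : Tm k (suc b)) →
         ((f ⊗ idₜ b) ∘ (η ⊗ F)) ≈ (((f ∘ (η ⊗ X)) ⊗ idₜ b) ∘ F)
onto-η f b F = begin
  (f ⊗ idₜ b) ∘ (η ⊗ F)                    ≈⟨ ≈-refl ⟨∘⟩ η-on-top F ⟨
  (f ⊗ idₜ b) ∘ ((η ⊗ idₜ (suc b)) ∘ F)    ≈⟨ ∘-assoc _ _ _ ⟨
  ((f ⊗ idₜ b) ∘ (η ⊗ idₜ (suc b))) ∘ F    ≈⟨ (≈-refl ⟨∘⟩ ⊗id-suc η b) ⟨∘⟩ ≈-refl ⟩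
  ((f ⊗ idₜ b) ∘ ((η ⊗ X) ⊗ idₜ b)) ∘ F    ≈⟨ ⊗id-fuse b _ _ ⟨∘⟩ ≈-refl ⟩
  ((f ∘ (η ⊗ X)) ⊗ idₜ b) ∘ F              ∎

μ∘η-cancel : ∀ {k} b (F : Tm k (suc b)) → ((μ ⊗ idₜ b) ∘ (η ⊗ F)) ≈ F
μ∘η-cancel b F = begin
  (μ ⊗ idₜ b) ∘ (η ⊗ F)         ≈⟨ onto-η μ b F ⟩
  ((μ ∘ (η ⊗ X)) ⊗ idₜ b) ∘ F   ≈⟨ ≈-trans (r4 ⟨⊗⟩ ≈-refl) (⊗-id 1 b) ⟨∘⟩ ≈-refl ⟩
  idₜ (suc b) ∘ F               ≈⟨ ∘-idˡ F ⟩
  F                             ∎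

δ∘η-copy : ∀ {k n} (F : Tm k n) → ((δ ⊗ idₜ n) ∘ (η ⊗ F)) ≈ (η ⊗ (η ⊗ F))
δ∘η-copy F = ≈-trans (fuse _ _ _ _) (≈-trans (r21 ⟨⊗⟩ ∘-idˡ F) (⊗-assoc η η F))

γ∘η-slide : ∀ {k} b (F : Tm k (suc b)) → ((γ ⊗ idₜ b) ∘ (η ⊗ F)) ≈ ((X ⊗ (η ⊗ idₜ b)) ∘ F)
γ∘η-slide b F = begin
  (γ ⊗ idₜ b) ∘ (η ⊗ F)         ≈⟨ onto-η γ b F ⟩
  ((γ ∘ (η ⊗ X)) ⊗ idₜ b) ∘ F   ≈⟨ (r8 ⟨⊗⟩ ≈-refl) ⟨∘⟩ ≈-refl ⟩
  ((X ⊗ η) ⊗ idₜ b) ∘ F         ≈⟨ X⊗-assoc η (idₜ b) ⟨∘⟩ ≈-refl ⟨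
  (X ⊗ (η ⊗ idₜ b)) ∘ F         ∎

block-pass : ∀ {m N N'} (L : Tm N N') (M : Tm (suc N) N) (M' : Tm (suc N') N') (F : Tm (suc m) N) →
        (L ∘ M) ≈ (M' ∘ (X ⊗ L)) →
        (L ∘ (M ∘ (X ⊗ F) ∘ (δ ⊗ idₜ m))) ≈ (M' ∘ (X ⊗ (L ∘ F)) ∘ (δ ⊗ idₜ m))
block-pass L M M' F eq = begin
  L ∘ (M ∘ (X ⊗ F) ∘ (δ ⊗ idₜ _)) ≈⟨ ∘-assoc _ _ _ ⟨
  (L ∘ M) ∘ (X ⊗ F) ∘ (δ ⊗ idₜ _) ≈⟨ eq ⟨∘⟩ ≈-refl ⟩
  (M' ∘ (X ⊗ L)) ∘ (X ⊗ F) ∘ (δ ⊗ idₜ _) ≈⟨ ∘-assoc _ _ _ ⟩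
  M' ∘ (X ⊗ L) ∘ (X ⊗ F) ∘ (δ ⊗ idₜ _) ≈⟨ ≈-refl ⟨∘⟩ ∘-assoc _ _ _ ⟨
  M' ∘ ((X ⊗ L) ∘ (X ⊗ F)) ∘ (δ ⊗ idₜ _) ≈⟨ ≈-refl ⟨∘⟩ X⊗-∘ _ _ ⟨∘⟩ ≈-refl ⟨
  M' ∘ (X ⊗ (L ∘ F)) ∘ (δ ⊗ idₜ _) ∎

ε-after-δ : ∀ {m n} (G' : Tm (suc m) n) → ((ε ⊗ G') ∘ (δ ⊗ idₜ m)) ≈ G'
ε-after-δ {m} G' = begin
  (ε ⊗ G') ∘ (δ ⊗ idₜ m) ≈⟨ factorʳ ε G' ⟨∘⟩ ≈-refl ⟩
  ((idₜ 0 ⊗ G') ∘ (ε ⊗ idₜ (suc m))) ∘ (δ ⊗ idₜ m) ≈⟨ ∘-assoc _ _ _ ⟩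
  (idₜ 0 ⊗ G') ∘ ((ε ⊗ idₜ (suc m)) ∘ (δ ⊗ idₜ m)) ≈⟨ ⊗-idˡ G' ⟨∘⟩ (⊗id-suc ε m ⟨∘⟩ ≈-refl) ⟩
  G' ∘ (((ε ⊗ X) ⊗ idₜ m) ∘ (δ ⊗ idₜ m)) ≈⟨ ≈-refl ⟨∘⟩ ⊗id-fuse m _ _ ⟩
  G' ∘ (((ε ⊗ X) ∘ δ) ⊗ idₜ m) ≈⟨ ≈-refl ⟨∘⟩ ≈-trans (r12 ⟨⊗⟩ ≈-refl) (⊗-id 1 m) ⟩
  G' ∘ idₜ (suc m) ≈⟨ ∘-idʳ G' ⟩
  G' ∎

block-kill : ∀ {m N N'} (L : Tm N N') (M : Tm (suc N) N) (F : Tm (suc m) N) →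
        (L ∘ M) ≈ (ε ⊗ L) →
        (L ∘ (M ∘ (X ⊗ F) ∘ (δ ⊗ idₜ m))) ≈ (L ∘ F)
block-kill L M F eq = begin
  L ∘ (M ∘ (X ⊗ F) ∘ (δ ⊗ idₜ _)) ≈⟨ ∘-assoc _ _ _ ⟨
  (L ∘ M) ∘ (X ⊗ F) ∘ (δ ⊗ idₜ _) ≈⟨ eq ⟨∘⟩ ≈-refl ⟩
  (ε ⊗ L) ∘ (X ⊗ F) ∘ (δ ⊗ idₜ _) ≈⟨ ∘-assoc _ _ _ ⟨
  ((ε ⊗ L) ∘ (X ⊗ F)) ∘ (δ ⊗ idₜ _) ≈⟨ fuse _ _ _ _ ⟨∘⟩ ≈-refl ⟩
  ((ε ∘ X) ⊗ (L ∘ F)) ∘ (δ ⊗ idₜ _) ≈⟨ (∘-idʳ ε ⟨⊗⟩ ≈-refl) ⟨∘⟩ ≈-refl ⟩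
  (ε ⊗ (L ∘ F)) ∘ (δ ⊗ idₜ _) ≈⟨ ε-after-δ _ ⟩
  L ∘ F ∎

-- Coassociativity r11, used to split one copy into two nested W-blocks.
δ-coassoc-block : ∀ {m n} (G' : Tm (suc m) n) →
     ((δ ⊗ G') ∘ (δ ⊗ idₜ m)) ≈ ((X ⊗ (X ⊗ G')) ∘ (X ⊗ (δ ⊗ idₜ m)) ∘ (δ ⊗ idₜ m))
δ-coassoc-block {m} G' = begin
  (δ ⊗ G') ∘ (δ ⊗ idₜ m) ≈⟨ factorʳ δ G' ⟨∘⟩ ≈-refl ⟩
  ((idₜ 2 ⊗ G') ∘ (δ ⊗ idₜ (suc m))) ∘ (δ ⊗ idₜ m) ≈⟨ ∘-assoc _ _ _ ⟩
  (idₜ 2 ⊗ G') ∘ ((δ ⊗ idₜ (suc m)) ∘ (δ ⊗ idₜ m)) ≈⟨ id₂⊗ G' ⟨∘⟩ (⊗id-suc δ m ⟨∘⟩ ≈-refl) ⟩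
  (X ⊗ (X ⊗ G')) ∘ (((δ ⊗ X) ⊗ idₜ m) ∘ (δ ⊗ idₜ m)) ≈⟨ ≈-refl ⟨∘⟩ ⊗id-fuse m _ _ ⟩
  (X ⊗ (X ⊗ G')) ∘ (((δ ⊗ X) ∘ δ) ⊗ idₜ m) ≈⟨ ≈-refl ⟨∘⟩ (r11 ⟨⊗⟩ ≈-refl) ⟩
  (X ⊗ (X ⊗ G')) ∘ (((X ⊗ δ) ∘ δ) ⊗ idₜ m) ≈⟨ ≈-refl ⟨∘⟩ ⊗id-fuse m _ _ ⟨
  (X ⊗ (X ⊗ G')) ∘ (((X ⊗ δ) ⊗ idₜ m) ∘ (δ ⊗ idₜ m)) ≈⟨ ≈-refl ⟨∘⟩ (X⊗-assoc δ (idₜ m) ⟨∘⟩ ≈-refl) ⟨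
  (X ⊗ (X ⊗ G')) ∘ (X ⊗ (δ ⊗ idₜ m)) ∘ (δ ⊗ idₜ m) ∎

block-dup : ∀ {m N N'} (L : Tm N N') (M : Tm (suc N) N) (M1 M2 : Tm (suc N') N') (F : Tm (suc m) N) →
        (L ∘ M) ≈ (M1 ∘ (X ⊗ M2) ∘ (δ ⊗ L)) →
        (L ∘ (M ∘ (X ⊗ F) ∘ (δ ⊗ idₜ m))) ≈
        (M1 ∘ (X ⊗ (M2 ∘ (X ⊗ (L ∘ F)) ∘ (δ ⊗ idₜ m))) ∘ (δ ⊗ idₜ m))
block-dup {m} L M M1 M2 F eq = begin
  L ∘ (M ∘ (X ⊗ F) ∘ (δ ⊗ idₜ m)) ≈⟨ ∘-assoc _ _ _ ⟨
  (L ∘ M) ∘ (X ⊗ F) ∘ (δ ⊗ idₜ m) ≈⟨ eq ⟨∘⟩ ≈-refl ⟩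
  (M1 ∘ (X ⊗ M2) ∘ (δ ⊗ L)) ∘ (X ⊗ F) ∘ (δ ⊗ idₜ m) ≈⟨ ≈-trans (∘-assoc _ _ _) (≈-refl ⟨∘⟩ ∘-assoc _ _ _) ⟩
  M1 ∘ (X ⊗ M2) ∘ (δ ⊗ L) ∘ (X ⊗ F) ∘ (δ ⊗ idₜ m) ≈⟨ ≈-refl ⟨∘⟩ ≈-refl ⟨∘⟩ ∘-assoc _ _ _ ⟨
  M1 ∘ (X ⊗ M2) ∘ ((δ ⊗ L) ∘ (X ⊗ F)) ∘ (δ ⊗ idₜ m)
    ≈⟨ ≈-refl ⟨∘⟩ ≈-refl ⟨∘⟩ ≈-trans (fuse _ _ _ _) (∘-idʳ δ ⟨⊗⟩ ≈-refl) ⟨∘⟩ ≈-refl ⟩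
  M1 ∘ (X ⊗ M2) ∘ (δ ⊗ (L ∘ F)) ∘ (δ ⊗ idₜ m) ≈⟨ ≈-refl ⟨∘⟩ ≈-refl ⟨∘⟩ δ-coassoc-block (L ∘ F) ⟩
  M1 ∘ (X ⊗ M2) ∘ (X ⊗ (X ⊗ (L ∘ F))) ∘ (X ⊗ (δ ⊗ idₜ m)) ∘ (δ ⊗ idₜ m)
    ≈⟨ ≈-refl ⟨∘⟩ ≈-trans (∘-assoc (X ⊗ M2) _ _) (≈-refl ⟨∘⟩ ∘-assoc (X ⊗ (X ⊗ (L ∘ F))) _ _) ⟨
  M1 ∘ (((X ⊗ M2) ∘ ((X ⊗ (X ⊗ (L ∘ F))) ∘ (X ⊗ (δ ⊗ idₜ m)))) ∘ (δ ⊗ idₜ m))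
    ≈⟨ ≈-refl ⟨∘⟩ ((≈-trans (X⊗-∘ M2 _) (≈-refl ⟨∘⟩ X⊗-∘ (X ⊗ (L ∘ F)) (δ ⊗ idₜ m))) ⟨∘⟩ ≈-refl) ⟨
  M1 ∘ (X ⊗ (M2 ∘ (X ⊗ (L ∘ F)) ∘ (δ ⊗ idₜ m))) ∘ (δ ⊗ idₜ m) ∎

-- Induction on the normal form: E-steps
-- commute with the layer, W-steps use push-layer, and an H-step at the
-- layer's own wire is resolved by the unit/counit relations.
absorb : ∀ {p q} (g : Gen p q) b {N N'} (c : Ctx (p + b) (q + b) N N') {k} (ψ : NF k N) →
         HasNF (plug c (⌜ g ⌝ ⊗ idₜ b) ∘ ⟦ ψ ⟧)
absorb g b c (nf-E ψ) with absorb g b c ψ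
... | ρ , eq = nf-E ρ , ≈-trans (ε-slide-out _ _) (≈-refl ⟨⊗⟩ eq)
absorb g b c (nf-W i ψ) with push-layer g b c i | absorb g b c ψ
... | pass i' eq   | ρ , eq' = nf-W i' ρ ,
        ≈-trans (block-pass _ _ _ _ eq) (≈-refl ⟨∘⟩ (≈-refl ⟨⊗⟩ eq') ⟨∘⟩ ≈-refl)
... | kill eq      | ρ , eq' = ρ , ≈-trans (block-kill _ _ _ eq) eq'
... | dup i₁ i₂ eq | ρ , eq' = nf-W i₁ (nf-W i₂ ρ) ,
        ≈-trans (block-dup _ _ _ _ _ eq) (≈-refl ⟨∘⟩ (≈-refl ⟨⊗⟩ (≈-refl ⟨∘⟩ (≈-refl ⟨⊗⟩ eq') ⟨∘⟩ ≈-refl)) ⟨∘⟩ ≈-refl)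
absorb gμ b (os c) (nf-H ψ) = η-below (absorb gμ b c ψ)
absorb gη b (os c) (nf-H ψ) = η-below (absorb gη b c ψ)
absorb gδ b (os c) (nf-H ψ) = η-below (absorb gδ b c ψ)
absorb gε b (os c) (nf-H ψ) = η-below (absorb gε b c ψ)
absorb gγ b (os c) (nf-H ψ) = η-below (absorb gγ b c ψ)
absorb gη b oz (nf-H ψ) = nf-H (nf-H ψ) , η-on-top _
absorb gε b oz (nf-H ψ) = ψ , ε∘η-cancel _
absorb gμ b oz (nf-H ψ) = ψ , μ∘η-cancel b _
absorb gδ b oz (nf-H ψ) = nf-H (nf-H ψ) , δ∘η-copy _
absorb gγ b oz (nf-H ψ) = HasNF-≈ (γ∘η-slide b _) (absorb gη b (os oz) ψ)
absorb gη b oz nf-Z = nf-H nf-Z , η-on-top _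

-- Closure of normal forms under composition

-- Addition recursing on the first argument into the second, so that
-- whisker (suc a) f is whisker a (X ⊗ f) by definition.
_⊕_ : ℕ → ℕ → ℕ
zero  ⊕ m = m
suc a ⊕ m = a ⊕ suc m

whisker : ∀ a {m n} → Tm m n → Tm (a ⊕ m) (a ⊕ n)
whisker zero    f = f
whisker (suc a) f = whisker a (X ⊗ f)

whisker-cong : ∀ a {m n} {f g : Tm m n} → f ≈ g → whisker a f ≈ whisker a g
whisker-cong zero    eq = eq
whisker-cong (suc a) eq = whisker-cong a (≈-refl ⟨⊗⟩ eq)

whisker-∘ : ∀ a {k m n} (f : Tm m n) (g : Tm k m) → whisker a (f ∘ g) ≈ (whisker a f ∘ whisker a g)
whisker-∘ zero    f g = ≈-refl
whisker-∘ (suc a) f g = ≈-trans (whisker-cong a (X⊗-∘ f g)) (whisker-∘ a (X ⊗ f) (X ⊗ g))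

whisker-id : ∀ a m → whisker a (idₜ m) ≈ idₜ (a ⊕ m)
whisker-id zero    m = ≈-refl
whisker-id (suc a) m = ≈-trans (whisker-cong a (⊗-id 1 m)) (whisker-id a (suc m))

-- A whiskered morphism is also a plugged context, whose wires are peeled
-- from the outside instead (the form absorb recurses on).
inner : ∀ {m n M N} → Ctx (suc m) (suc n) M N → Ctx m n M N
inner oz     = os oz
inner (os c) = os (inner c)

plug-inner : ∀ {m n M N} (c : Ctx (suc m) (suc n) M N) (f : Tm m n) → plug (inner c) f ≈ plug c (X ⊗ f)
plug-inner oz     f = ≈-refl
plug-inner (os c) f = ≈-refl ⟨⊗⟩ plug-inner c f

whisker-ctx : ∀ a {m n} → Ctx m n (a ⊕ m) (a ⊕ n)
whisker-ctx zero    = oz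
whisker-ctx (suc a) = inner (whisker-ctx a)

whisker≈plug : ∀ a {m n} (f : Tm m n) → whisker a f ≈ plug (whisker-ctx a) f
whisker≈plug zero    f = ≈-refl
whisker≈plug (suc a) f = ≈-trans (whisker≈plug a (X ⊗ f)) (≈-sym (plug-inner (whisker-ctx a) f))

Absorbs : ℕ → ∀ {m n} → Tm m n → Set
Absorbs a {m} f = ∀ {k} (ψ : NF k (a ⊕ m)) → HasNF (whisker a f ∘ ⟦ ψ ⟧)

absorbs-≈ : ∀ a {m n} {f g : Tm m n} → f ≈ g → Absorbs a f → Absorbs a g
absorbs-≈ a f≈g absorbs-f ψ = HasNF-≈ (whisker-cong a (≈-sym f≈g) ⟨∘⟩ ≈-refl) (absorbs-f ψ)

absorbs-∘ : ∀ a {l m n} {f : Tm m n} {g : Tm l m} → Absorbs a f → Absorbs a g → Absorbs a (f ∘ g)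
absorbs-∘ a {f = f} {g} absorbs-f absorbs-g ψ with absorbs-g ψ
... | ρ , eq with absorbs-f ρ
... | ρ' , eq' = ρ' , (begin
  whisker a (f ∘ g) ∘ ⟦ ψ ⟧               ≈⟨ whisker-∘ a f g ⟨∘⟩ ≈-refl ⟩
  (whisker a f ∘ whisker a g) ∘ ⟦ ψ ⟧     ≈⟨ ∘-assoc _ _ _ ⟩
  whisker a f ∘ (whisker a g ∘ ⟦ ψ ⟧)     ≈⟨ ≈-refl ⟨∘⟩ eq ⟩
  whisker a f ∘ ⟦ ρ ⟧                     ≈⟨ eq' ⟩
  ⟦ ρ' ⟧                                  ∎)

absorbs-generator : ∀ {p q} (g : Gen p q) b a → Absorbs a (⌜ g ⌝ ⊗ idₜ b)
absorbs-generator g b a ψ = HasNF-≈ (whisker≈plug a _ ⟨∘⟩ ≈-refl) (absorb g b (whisker-ctx a) ψ)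

absorbs-merge : ∀ a {n} (i : Fin n) → Absorbs a (merge i)
absorbs-merge a {suc n} zero    = absorbs-generator gμ n a
absorbs-merge a {suc n} (suc i) = absorbs-∘ a (absorbs-merge (suc a) i) (absorbs-generator gγ n a)

absorbs-NF : ∀ a {m n} (φ : NF m n) → Absorbs a ⟦ φ ⟧
absorbs-NF a nf-Z ψ = ψ , ≈-trans (whisker-id a 0 ⟨∘⟩ ≈-refl) (∘-idˡ _)
absorbs-NF a (nf-H {n = n} φ) =
  absorbs-≈ a (η-on-top _) (absorbs-∘ a (absorbs-generator gη n a) (absorbs-NF a φ))
absorbs-NF a (nf-E {m} φ) =
  absorbs-≈ a ε-first (absorbs-∘ a (absorbs-NF a φ) (absorbs-generator gε m a))
  where
  ε-first : (⟦ φ ⟧ ∘ (ε ⊗ idₜ m)) ≈ (ε ⊗ ⟦ φ ⟧)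
  ε-first = ≈-sym (≈-trans (factorʳ ε _) (⊗-idˡ _ ⟨∘⟩ ≈-refl))
absorbs-NF a (nf-W {m} i φ) =
  absorbs-∘ a (absorbs-merge a i) (absorbs-∘ a (absorbs-NF (suc a) φ) (absorbs-generator gδ m a))

compose-NF : ∀ {k m n} {f : Tm m n} {g : Tm k m} → HasNF f → HasNF g → HasNF (f ∘ g)
compose-NF (φ , f≈φ) (ψ , g≈ψ) = HasNF-≈ (f≈φ ⟨∘⟩ g≈ψ) (absorbs-NF 0 φ ψ)

μ-unit-block : ∀ b → ((μ ⊗ idₜ b) ∘ (X ⊗ (η ⊗ idₜ b))) ≈ idₜ (suc b)
μ-unit-block b = begin
  (μ ⊗ idₜ b) ∘ (X ⊗ (η ⊗ idₜ b))    ≈⟨ ≈-refl ⟨∘⟩ X⊗-assoc η (idₜ b) ⟩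
  (μ ⊗ idₜ b) ∘ ((X ⊗ η) ⊗ idₜ b)    ≈⟨ ⊗id-fuse b _ _ ⟩
  (μ ∘ (X ⊗ η)) ⊗ idₜ b              ≈⟨ r5 ⟨⊗⟩ ≈-refl ⟩
  X ⊗ idₜ b                          ≈⟨ ⊗-id 1 b ⟩
  idₜ (suc b)                        ∎

δ-counit-block : ∀ b → ((X ⊗ (ε ⊗ idₜ b)) ∘ (δ ⊗ idₜ b)) ≈ idₜ (suc b)
δ-counit-block b = begin
  (X ⊗ (ε ⊗ idₜ b)) ∘ (δ ⊗ idₜ b)    ≈⟨ X⊗-assoc ε (idₜ b) ⟨∘⟩ ≈-refl ⟩
  ((X ⊗ ε) ⊗ idₜ b) ∘ (δ ⊗ idₜ b)    ≈⟨ ⊗id-fuse b _ _ ⟩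
  ((X ⊗ ε) ∘ δ) ⊗ idₜ b              ≈⟨ r13 ⟨⊗⟩ ≈-refl ⟩
  X ⊗ idₜ b                          ≈⟨ ⊗-id 1 b ⟩
  idₜ (suc b)                        ∎

-- A wire followed by R is the W-block W₀ E H R: copy the wire, discard
-- one copy, create a fresh wire and merge it back.
wire-as-block : ∀ {n n'} (R : Tm n n') → ((μ ⊗ idₜ n') ∘ (X ⊗ (ε ⊗ (η ⊗ R))) ∘ (δ ⊗ idₜ n)) ≈ (X ⊗ R)
wire-as-block {n} {n'} R = begin
  (μ ⊗ idₜ n') ∘ (X ⊗ (ε ⊗ (η ⊗ R))) ∘ (δ ⊗ idₜ n)
    ≈⟨ ≈-refl ⟨∘⟩ (≈-refl ⟨⊗⟩ η-R-ε) ⟨∘⟩ ≈-refl ⟩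
  (μ ⊗ idₜ n') ∘ (X ⊗ ((η ⊗ idₜ n') ∘ R ∘ (ε ⊗ idₜ n))) ∘ (δ ⊗ idₜ n)
    ≈⟨ ≈-refl ⟨∘⟩ ≈-trans (X⊗-∘ _ _) (≈-refl ⟨∘⟩ X⊗-∘ _ _) ⟨∘⟩ ≈-refl ⟩
  (μ ⊗ idₜ n') ∘ ((X ⊗ (η ⊗ idₜ n')) ∘ (X ⊗ R) ∘ (X ⊗ (ε ⊗ idₜ n))) ∘ (δ ⊗ idₜ n)
    ≈⟨ ≈-trans (≈-refl ⟨∘⟩ ≈-trans (∘-assoc _ _ _) (≈-refl ⟨∘⟩ ∘-assoc _ _ _)) (≈-sym (∘-assoc _ _ _)) ⟩
  ((μ ⊗ idₜ n') ∘ (X ⊗ (η ⊗ idₜ n'))) ∘ (X ⊗ R) ∘ ((X ⊗ (ε ⊗ idₜ n)) ∘ (δ ⊗ idₜ n))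
    ≈⟨ μ-unit-block n' ⟨∘⟩ ≈-refl ⟨∘⟩ δ-counit-block n ⟩
  idₜ (suc n') ∘ (X ⊗ R) ∘ idₜ (suc n)
    ≈⟨ ≈-trans (∘-idˡ _) (∘-idʳ _) ⟩
  X ⊗ R ∎
  where
  η-R-ε : (ε ⊗ (η ⊗ R)) ≈ ((η ⊗ idₜ n') ∘ R ∘ (ε ⊗ idₜ n))
  η-R-ε = begin
    ε ⊗ (η ⊗ R)                       ≈⟨ factorʳ ε (η ⊗ R) ⟩
    (idₜ 0 ⊗ (η ⊗ R)) ∘ (ε ⊗ idₜ n)   ≈⟨ ⊗-idˡ _ ⟨∘⟩ ≈-refl ⟩
    (η ⊗ R) ∘ (ε ⊗ idₜ n)             ≈⟨ η-on-top R ⟨∘⟩ ≈-refl ⟨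
    ((η ⊗ idₜ n') ∘ R) ∘ (ε ⊗ idₜ n)  ≈⟨ ∘-assoc _ _ _ ⟩
    (η ⊗ idₜ n') ∘ R ∘ (ε ⊗ idₜ n)    ∎

identity-NF : ∀ n → HasNF (idₜ n)
identity-NF zero = nf-Z , ≈-refl
identity-NF (suc n) with identity-NF n
... | ρ , eq = nf-W zero (nf-E (nf-H ρ)) ,
               ≈-sym (≈-trans (wire-as-block ⟦ ρ ⟧) (≈-trans (≈-refl ⟨⊗⟩ ≈-sym eq) (⊗-id 1 n)))

-- A generator is absorbed by the normal form of the identity.
generator-NF : ∀ {p q} (g : Gen p q) → HasNF (⌜ g ⌝ ⊗ idₜ 0)
generator-NF {p} g with identity-NF (p + 0)
... | ρ , eq = HasNF-≈ (≈-trans (≈-sym (∘-idʳ _)) (≈-refl ⟨∘⟩ eq)) (absorbs-generator g 0 0 ρ)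

-- Normal forms are closed under tensor product

merge-⊗id : ∀ {n} (i : Fin n) c → (merge i ⊗ idₜ c) ≈ merge (i ↑ˡ c)
merge-⊗id {suc n} zero c = ≈-trans (⊗-assoc μ (idₜ n) (idₜ c)) (≈-refl ⟨⊗⟩ ⊗-id n c)
merge-⊗id {suc n} (suc i) c = begin
  ((X ⊗ merge i) ∘ (γ ⊗ idₜ n)) ⊗ idₜ c ≈⟨ ⊗id-fuse c _ _ ⟨
  ((X ⊗ merge i) ⊗ idₜ c) ∘ ((γ ⊗ idₜ n) ⊗ idₜ c) ≈⟨ ⊗-assoc X _ _ ⟨∘⟩ ⊗-assoc γ _ _ ⟩
  (X ⊗ (merge i ⊗ idₜ c)) ∘ (γ ⊗ (idₜ n ⊗ idₜ c)) ≈⟨ (≈-refl ⟨⊗⟩ merge-⊗id i c) ⟨∘⟩ (≈-refl ⟨⊗⟩ ⊗-id n c) ⟩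
  (X ⊗ merge (i ↑ˡ c)) ∘ (γ ⊗ idₜ (n + c)) ∎

-- A normal form for f ⊗ g: the steps of f, each widened by g's wires,
-- applied to the normal form of g.
⊗-NF : ∀ {m1 n1 m2 n2} (ψ1 : NF m1 n1) (ψ2 : NF m2 n2) → HasNF (⟦ ψ1 ⟧ ⊗ ⟦ ψ2 ⟧)
⊗-NF nf-Z ψ2 = ψ2 , ⊗-idˡ _
⊗-NF (nf-H ψ1) ψ2 with ⊗-NF ψ1 ψ2
... | ρ , eq = nf-H ρ , ≈-trans (⊗-assoc η _ _) (≈-refl ⟨⊗⟩ eq)
⊗-NF (nf-E ψ1) ψ2 with ⊗-NF ψ1 ψ2
... | ρ , eq = nf-E ρ , ≈-trans (⊗-assoc ε _ _) (≈-refl ⟨⊗⟩ eq)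
⊗-NF {m2 = m2} {n2 = n2} (nf-W {m} i ψ1) ψ2 with ⊗-NF ψ1 ψ2
... | ρ , eq = nf-W (i ↑ˡ n2) ρ , (begin
  (merge i ∘ (X ⊗ ⟦ ψ1 ⟧) ∘ (δ ⊗ idₜ m)) ⊗ ⟦ ψ2 ⟧
    ≈⟨ ≈-refl ⟨⊗⟩ ≈-trans (∘-idˡ _) (∘-idʳ _) ⟨
  (merge i ∘ (X ⊗ ⟦ ψ1 ⟧) ∘ (δ ⊗ idₜ m)) ⊗ (idₜ n2 ∘ ⟦ ψ2 ⟧ ∘ idₜ m2)
    ≈⟨ interchange _ _ _ _ ⟩
  (merge i ⊗ idₜ n2) ∘ (((X ⊗ ⟦ ψ1 ⟧) ∘ (δ ⊗ idₜ m)) ⊗ (⟦ ψ2 ⟧ ∘ idₜ m2))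
    ≈⟨ ≈-refl ⟨∘⟩ interchange _ _ _ _ ⟩
  (merge i ⊗ idₜ n2) ∘ ((X ⊗ ⟦ ψ1 ⟧) ⊗ ⟦ ψ2 ⟧) ∘ ((δ ⊗ idₜ m) ⊗ idₜ m2)
    ≈⟨ merge-⊗id i n2 ⟨∘⟩ ⊗-assoc X _ _ ⟨∘⟩ ≈-trans (⊗-assoc δ _ _) (≈-refl ⟨⊗⟩ ⊗-id m m2) ⟩
  merge (i ↑ˡ n2) ∘ (X ⊗ (⟦ ψ1 ⟧ ⊗ ⟦ ψ2 ⟧)) ∘ (δ ⊗ idₜ (m + m2))
    ≈⟨ ≈-refl ⟨∘⟩ (≈-refl ⟨⊗⟩ eq) ⟨∘⟩ ≈-refl ⟩
  merge (i ↑ˡ n2) ∘ (X ⊗ ⟦ ρ ⟧) ∘ (δ ⊗ idₜ (m + m2)) ∎)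

tensor-NF : ∀ {m n m' n'} {f : Tm m n} {g : Tm m' n'} → HasNF f → HasNF g → HasNF (f ⊗ g)
tensor-NF (φ , f≈φ) (ψ , g≈ψ) = HasNF-≈ (f≈φ ⟨⊗⟩ g≈ψ) (⊗-NF φ ψ)

normalise : ∀ {m n} (φ : Tm m n) → HasNF φ
normalise (idₜ n) = identity-NF n
normalise μ       = HasNF-≈ (≈-sym (⊗-idʳ μ)) (generator-NF gμ)
normalise η       = HasNF-≈ (≈-sym (⊗-idʳ η)) (generator-NF gη)
normalise δ       = HasNF-≈ (≈-sym (⊗-idʳ δ)) (generator-NF gδ)
normalise ε       = HasNF-≈ (≈-sym (⊗-idʳ ε)) (generator-NF gε)
normalise γ       = HasNF-≈ (≈-sym (⊗-idʳ γ)) (generator-NF gγ)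
normalise (f ∘ g) = compose-NF (normalise f) (normalise g)
normalise (f ⊗ g) = tensor-NF (normalise f) (normalise g)

-- From normal forms to precanonical forms

-- Equivalence of morphisms whose (co)domains are only propositionally
-- equal; it lets the casts in the definition of W_i be moved around.
infix 4 _≅_
_≅_ : ∀ {m n m' n'} → Tm m n → Tm m' n' → Set
_≅_ {m} {n} {m'} {n'} f g = Σ (m ≡ m') λ p → Σ (n ≡ n') λ q → cast p q f ≈ g

-- Casts depend only on the endpoints (ℕ has unique equality proofs) and
-- commute with composition and tensor.
cast-irr : ∀ {m n m' n'} (p p' : m ≡ m') (q q' : n ≡ n') (f : Tm m n) → cast p q f ≡ cast p' q' f
cast-irr p p' q q' f = cong₂ (λ a b → cast a b f) (≡-irrelevant p p') (≡-irrelevant q q')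

cast-cancelˡ : ∀ {m n m' n'} (p : m ≡ m') (q : n ≡ n') (f : Tm m n) → cast (sym p) (sym q) (cast p q f) ≡ f
cast-cancelˡ refl refl f = refl

cast-tr : ∀ {m n m' n' m'' n''} (p : m ≡ m') (q : n ≡ n') (p' : m' ≡ m'') (q' : n' ≡ n'') (f : Tm m n) →
          cast (trans p p') (trans q q') f ≡ cast p' q' (cast p q f)
cast-tr refl refl refl refl f = refl

cast-∘ : ∀ {k m n k' m' n'} (r : k ≡ k') (p : m ≡ m') (q : n ≡ n') (f : Tm m n) (g : Tm k m) →
         cast r q (f ∘ g) ≡ (cast p q f ∘ cast r p g)
cast-∘ refl refl refl f g = refl

cast-⊗ : ∀ {m n m' n' a b a' b'} (p : m ≡ m') (q : n ≡ n') (r : a ≡ a') (s : b ≡ b') (f : Tm m n) (g : Tm a b) →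
         cast (cong₂ _+_ p r) (cong₂ _+_ q s) (f ⊗ g) ≡ (cast p q f ⊗ cast r s g)
cast-⊗ refl refl refl refl f g = refl

≈→≅ : ∀ {m n} {f g : Tm m n} → f ≈ g → f ≅ g
≈→≅ eq = refl , refl , eq

≅→≈ : ∀ {m n} {f g : Tm m n} → f ≅ g → f ≈ g
≅→≈ {f = f} (p , q , eq) = ≈-trans (≡→≈ (cast-irr refl p refl q f)) eq

≅-sym : ∀ {m n m' n'} {f : Tm m n} {g : Tm m' n'} → f ≅ g → g ≅ f
≅-sym {f = f} (p , q , eq) = sym p , sym q , ≈-trans (cast-≈ (sym p) (sym q) (≈-sym eq)) (≡→≈ (cast-cancelˡ p q f))

≅-trans : ∀ {m n m' n' m'' n''} {f : Tm m n} {g : Tm m' n'} {h : Tm m'' n''} → f ≅ g → g ≅ h → f ≅ h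
≅-trans {f = f} (p , q , e1) (p' , q' , e2) =
  trans p p' , trans q q' , ≈-trans (≡→≈ (cast-tr p q p' q' f)) (≈-trans (cast-≈ p' q' e1) e2)

≅-∘ : ∀ {k m n k' m' n'} {f : Tm m n} {f' : Tm m' n'} {g : Tm k m} {g' : Tm k' m'} →
     f ≅ f' → g ≅ g' → (f ∘ g) ≅ (f' ∘ g')
≅-∘ {f = f} {g = g} (p , q , e1) (r , s , e2) =
  r , q , ≈-trans (≡→≈ (cast-∘ r p q f g)) (e1 ⟨∘⟩ ≈-trans (≡→≈ (cast-irr r r p s g)) e2)

≅-⊗ : ∀ {m n m' n' a b a' b'} {f : Tm m n} {f' : Tm m' n'} {g : Tm a b} {g' : Tm a' b'} →
     f ≅ f' → g ≅ g' → (f ⊗ g) ≅ (f' ⊗ g')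
≅-⊗ {f = f} {g = g} (p , q , e1) (r , s , e2) =
  cong₂ _+_ p r , cong₂ _+_ q s , ≈-trans (≡→≈ (cast-⊗ p q r s f g)) (e1 ⟨⊗⟩ e2)

cast-≅ : ∀ {m n m' n'} (p : m ≡ m') (q : n ≡ n') (f : Tm m n) → cast p q f ≅ f
cast-≅ p q f = ≅-sym (p , q , ≈-refl)

id-≅ : ∀ {m m'} → m ≡ m' → idₜ m ≅ idₜ m'
id-≅ refl = ≈→≅ ≈-refl

≅-refl : ∀ {m n} {f : Tm m n} → f ≅ f
≅-refl = ≈→≅ ≈-refl

-- Stairs built by recursion on the other side: the first wire is first
-- swapped past its neighbour and then carried further below one wire.
-- Unlike Defs.stair, this needs no casts.
stairᵣ : (i : ℕ) → Tm (suc i) (suc i)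
stairᵣ zero = X
stairᵣ (suc i) = (X ⊗ stairᵣ i) ∘ (γ ⊗ idₜ i)

mergeAt : (i j : ℕ) → Tm (suc (i + suc j)) (i + suc j)
mergeAt i j = cast (+-suc i (suc j)) refl (idₜ i ⊗ (μ ⊗ idₜ j))

merge≅mergeAt : ∀ i j (k : Fin (suc (i + j))) → toℕ k ≡ i → merge k ≅ (mergeAt i j ∘ (stairᵣ i ⊗ idₜ (suc j)))
merge≅mergeAt zero j zero tk = ≈→≅ (≈-sym (≈-trans (⊗-idˡ _ ⟨∘⟩ ⊗-id 1 (suc j)) (∘-idʳ _)))
merge≅mergeAt (suc i) j (suc k) tk = ≅-trans merge-suc-by-induction (≈→≅ regroup-stairs)
  where
  merge-suc-by-induction : merge (suc k) ≅ ((X ⊗ (mergeAt i j ∘ (stairᵣ i ⊗ idₜ (suc j)))) ∘ (γ ⊗ idₜ (i + suc j)))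
  merge-suc-by-induction = ≅-∘ (≅-⊗ ≅-refl (merge≅mergeAt i j k (suc-injective tk))) (≅-⊗ ≅-refl (id-≅ (sym (+-suc i j))))
  X⊗mergeAt : (X ⊗ mergeAt i j) ≈ mergeAt (suc i) j
  X⊗mergeAt = ≅→≈ (≅-trans (≅-⊗ ≅-refl (cast-≅ _ _ _))
         (≅-trans (≈→≅ (≈-sym (idsuc⊗ i (μ ⊗ idₜ j)))) (≅-sym (cast-≅ _ _ _))))
  regroup-stairs : ((X ⊗ (mergeAt i j ∘ (stairᵣ i ⊗ idₜ (suc j)))) ∘ (γ ⊗ idₜ (i + suc j))) ≈
          (mergeAt (suc i) j ∘ (stairᵣ (suc i) ⊗ idₜ (suc j)))
  regroup-stairs = begin
    (X ⊗ (mergeAt i j ∘ (stairᵣ i ⊗ idₜ (suc j)))) ∘ (γ ⊗ idₜ (i + suc j)) ≈⟨ X⊗-∘ _ _ ⟨∘⟩ ≈-refl ⟩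
    ((X ⊗ mergeAt i j) ∘ (X ⊗ (stairᵣ i ⊗ idₜ (suc j)))) ∘ (γ ⊗ idₜ (i + suc j)) ≈⟨ ∘-assoc _ _ _ ⟩
    (X ⊗ mergeAt i j) ∘ ((X ⊗ (stairᵣ i ⊗ idₜ (suc j))) ∘ (γ ⊗ idₜ (i + suc j)))
      ≈⟨ X⊗mergeAt ⟨∘⟩ (X⊗-assoc _ _ ⟨∘⟩ ≈-trans (≈-refl ⟨⊗⟩ ≈-sym (⊗-id i (suc j))) (≈-sym (⊗-assoc γ (idₜ i) (idₜ (suc j))))) ⟩
    mergeAt (suc i) j ∘ (((X ⊗ stairᵣ i) ⊗ idₜ (suc j)) ∘ ((γ ⊗ idₜ i) ⊗ idₜ (suc j))) ≈⟨ ≈-refl ⟨∘⟩ ⊗id-fuse (suc j) _ _ ⟩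
    mergeAt (suc i) j ∘ (stairᵣ (suc i) ⊗ idₜ (suc j)) ∎
merge≅mergeAt zero j (suc k) ()

swapLast : (i : ℕ) → Tm (2 + i) (2 + i)
swapLast i = cast (+-comm i 2) (+-comm i 2) (idₜ i ⊗ γ)
padLast : ∀ i → Tm (suc i) (suc i) → Tm (2 + i) (2 + i)
padLast i f = cast (cong suc (+-comm i 1)) (cong suc (+-comm i 1)) (f ⊗ idₜ 1)

stair-step : ∀ i → (swapLast i ∘ padLast i (stairᵣ i)) ≈ stairᵣ (suc i)
stair-step zero = begin
  (idₜ 0 ⊗ γ) ∘ (X ⊗ idₜ 1) ≈⟨ ⊗-idˡ γ ⟨∘⟩ ⊗-id 1 1 ⟩
  γ ∘ idₜ 2 ≈⟨ ∘-idʳ γ ⟩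
  γ ≈⟨ ∘-idˡ γ ⟨
  idₜ 2 ∘ γ ≈⟨ ⊗-id 1 1 ⟨∘⟩ ⊗-idʳ γ ⟨
  (X ⊗ X) ∘ (γ ⊗ idₜ 0) ∎
stair-step (suc i) = begin
  swapLast (suc i) ∘ padLast (suc i) (stairᵣ (suc i)) ≈⟨ swapLast-suc ⟨∘⟩ padLast-suc ⟩
  (X ⊗ swapLast i) ∘ ((X ⊗ padLast i (stairᵣ i)) ∘ (γ ⊗ idₜ (suc i))) ≈⟨ ∘-assoc _ _ _ ⟨
  ((X ⊗ swapLast i) ∘ (X ⊗ padLast i (stairᵣ i))) ∘ (γ ⊗ idₜ (suc i)) ≈⟨ X⊗-∘ _ _ ⟨∘⟩ ≈-refl ⟨
  (X ⊗ (swapLast i ∘ padLast i (stairᵣ i))) ∘ (γ ⊗ idₜ (suc i)) ≈⟨ (≈-refl ⟨⊗⟩ stair-step i) ⟨∘⟩ ≈-refl ⟩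
  (X ⊗ stairᵣ (suc i)) ∘ (γ ⊗ idₜ (suc i)) ∎
  where
  swapLast-suc : swapLast (suc i) ≈ (X ⊗ swapLast i)
  swapLast-suc = ≅→≈ (≅-trans (cast-≅ _ _ _) (≅-trans (≈→≅ (idsuc⊗ i γ)) (≅-⊗ ≅-refl (≅-sym (cast-≅ _ _ _)))))
  padLast-suc : padLast (suc i) (stairᵣ (suc i)) ≈ ((X ⊗ padLast i (stairᵣ i)) ∘ (γ ⊗ idₜ (suc i)))
  padLast-suc = ≅→≈ (≅-trans (cast-≅ _ _ _) (≅-trans (≈→≅ (≈-sym (⊗id-fuse 1 _ _)))
         (≅-∘ (≅-trans (≈→≅ (⊗-assoc X (stairᵣ i) X)) (≅-⊗ ≅-refl (≅-sym (cast-≅ _ _ _))))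
             (≅-trans (≈→≅ (⊗-assoc γ (idₜ i) X)) (≅-⊗ ≅-refl (≅-trans (≈→≅ (⊗-id i 1)) (id-≅ (+-comm i 1))))))))

stair≈stairᵣ : ∀ i → stair i ≈ stairᵣ i
stair≈stairᵣ zero = ≈-refl
stair≈stairᵣ (suc i) = ≈-trans (≈-refl ⟨∘⟩ cast-≈ _ _ (stair≈stairᵣ i ⟨⊗⟩ ≈-refl)) (stair-step i)

Wmor-prefix≈merge : ∀ i j (k : Fin (suc (i + j))) → toℕ k ≡ i →
     (cast (trans (+-suc i (suc j)) (cong suc (+-suc i j))) (+-suc i j) (idₜ i ⊗ μ ⊗ idₜ j)
       ∘ cast (cong suc (+-suc i j)) (cong suc (+-suc i j)) (stair i ⊗ idₜ (suc j))) ≈ merge k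
Wmor-prefix≈merge i j k tk = ≅→≈ (≅-trans
  (≅-∘ (≅-trans (cast-≅ (trans (+-suc i (suc j)) (cong suc (+-suc i j))) (+-suc i j) (idₜ i ⊗ μ ⊗ idₜ j))
            (≅-sym (cast-≅ (+-suc i (suc j)) refl (idₜ i ⊗ μ ⊗ idₜ j))))
      (≅-trans (cast-≅ _ _ _) (≈→≅ (stair≈stairᵣ i ⟨⊗⟩ ≈-refl))))
  (≅-sym (merge≅mergeAt i j k tk)))

HasPrecanonical : ∀ {m n} → Tm m n → Set
HasPrecanonical {m} {n} f = Σ (Tm m n) (λ ψ → Precanonical ψ × f ≈ ψ)

W-precanonical : ∀ {m' n'} i j (eq : i + j ≡ n') (k : Fin (suc n')) → toℕ k ≡ i →
      (F φ : Tm (suc m') (suc n')) → Precanonical φ → F ≈ φ →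
      HasPrecanonical (merge k ∘ (X ⊗ F) ∘ (δ ⊗ idₜ m'))
W-precanonical i j refl k tk F φ p eq = Wmor i j φ , W i j p ,
  ≈-trans (≈-refl ⟨∘⟩ (≈-refl ⟨⊗⟩ eq) ⟨∘⟩ ≈-refl)
          (≈-trans (≈-sym (Wmor-prefix≈merge i j k tk) ⟨∘⟩ ≈-refl) (∘-assoc _ _ _))

-- Every normal form denotes a term equivalent to a precanonical form; a
-- W-step at k : Fin (suc n') becomes W i j with i = k and j = n' ∸ k.
precanonical : ∀ {m n} (ψ : NF m n) → HasPrecanonical ⟦ ψ ⟧
precanonical nf-Z = idₜ 0 , Z , ≈-refl
precanonical (nf-H ψ) with precanonical ψ
... | φ , p , eq = η ⊗ φ , H p , ≈-refl ⟨⊗⟩ eq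
precanonical (nf-E ψ) with precanonical ψ
... | φ , p , eq = ε ⊗ φ , E p , ≈-refl ⟨⊗⟩ eq
precanonical (nf-W {n = suc n'} k ψ) with precanonical ψ
... | φ , p , eq = W-precanonical (toℕ k) (n' ∸ toℕ k) (m+[n∸m]≡n (toℕ≤pred[n] k)) k refl ⟦ ψ ⟧ φ p eq

mainTheorem2 : {m n : ℕ} (φ : Tm m n) → Σ (Tm m n) (λ ψ → Precanonical ψ × φ ≈ ψ)
mainTheorem2 φ with normalise φ
... | ρ , φ≈ρ with precanonical ρ
... | ψ , ψ-precanonical , ρ≈ψ = ψ , ψ-precanonical , ≈-trans φ≈ρ ρ≈ψ
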